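{- Let $p$ be a prime, $K=\mathrm{GL}_2(\mathbb Z_p)$, $K_0(p^n)=\begin{pmatrix}\mathbb Z_p^\times&\mathbb Z_p\\ p^n\mathbb Z_p&\mathbb Z_p^\times\end{pmatrix}$ and $H=\begin{pmatrix}1&0\\0&1+p\mathbb Z_p\end{pmatrix}$. For every $n\ge1$, \[|K_0(p^n)\backslash K/H|=(2n-1)(p-1)+2.\] -}

module Defs where

open import Data.Nat using (ℕ; zero; suc; _+_; _*_; _^_; _<_; _≤_; NonZero)
open import Data.Nat.Properties using (m^n≢0)
open import Data.Nat.DivMod using (_%_; m%n<n; %-distribˡ-+; %-distribˡ-*; m∣n⇒o%n%m≡o%m)
open import Data.Nat.Divisibility using (n∣m*n)
open import Data.Nat.Primality using (Prime; prime⇒nonZero)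
open import Data.Fin using (Fin)
open import Data.Product using (Σ; ∃; _×_; _,_)
open import Relation.Binary.PropositionalEquality using (_≡_; cong₂; trans)
open import Relation.Nullary using (¬_)

-- The p-adic integers ℤ_p, for a fixed nonzero p (used with p prime),
-- realised as the inverse limit of ℤ/p^k: an element is a compatible
-- sequence of residues x_k ∈ {0,…,p^k - 1} with x_{k+1} ≡ x_k (mod p^k).
module Padic (p : ℕ) .{{p≢0 : NonZero p}} where

  P : ℕ → ℕ
  P k = p ^ k

  _%P_ : ℕ → ℕ → ℕ
  m %P k = _%_ m (P k) {{m^n≢0 p k}}
  infixl 8 _%P_

  %P<P : ∀ m k → m %P k < P k
  %P<P m k = m%n<n m (P k) {{m^n≢0 p k}}

  reduce : ∀ m k → (m %P suc k) %P k ≡ m %P k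
  reduce m k = m∣n⇒o%n%m≡o%m (P k) (P (suc k)) m {{m^n≢0 p k}} {{m^n≢0 p (suc k)}} (n∣m*n p)

  +%P : ∀ m n k → (m + n) %P k ≡ (m %P k + n %P k) %P k
  +%P m n k = %-distribˡ-+ m n (P k) {{m^n≢0 p k}}

  *%P : ∀ m n k → (m * n) %P k ≡ (m %P k * n %P k) %P k
  *%P m n k = %-distribˡ-* m n (P k) {{m^n≢0 p k}}

  record ℤp : Set where
    constructor mkℤp
    field
      res   : ℕ → ℕ
      bound : ∀ k → res k < P k
      coh   : ∀ k → res (suc k) %P k ≡ res k
  open ℤp public

  infix 4 _≈_
  _≈_ : ℤp → ℤp → Set
  x ≈ y = ∀ k → res x k ≡ res y k

  ι : ℕ → ℤp
  ι m = mkℤp (λ k → m %P k) (λ k → %P<P m k) (λ k → reduce m k)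

  𝟘 𝟙 : ℤp
  𝟘 = ι 0
  𝟙 = ι 1

  _⊕_ : ℤp → ℤp → ℤp
  x ⊕ y = mkℤp (λ k → (res x k + res y k) %P k)
                (λ k → %P<P _ k)
                (λ k → trans (reduce (res x (suc k) + res y (suc k)) k)
                       (trans (+%P (res x (suc k)) (res y (suc k)) k)
                              (cong₂ (λ a b → (a + b) %P k) (coh x k) (coh y k))))

  _⊗_ : ℤp → ℤp → ℤp
  x ⊗ y = mkℤp (λ k → (res x k * res y k) %P k)
                (λ k → %P<P _ k)
                (λ k → trans (reduce (res x (suc k) * res y (suc k)) k)
                       (trans (*%P (res x (suc k)) (res y (suc k)) k)
                              (cong₂ (λ a b → (a * b) %P k) (coh x k) (coh y k))))

  infixl 6 _⊕_
  infixl 7 _⊗_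

  IsUnit : ℤp → Set
  IsUnit x = Σ ℤp λ y → x ⊗ y ≈ 𝟙

  record Mat : Set where
    constructor mat
    field
      a b c d : ℤp
  open Mat public

  infix 4 _≈M_
  _≈M_ : Mat → Mat → Set
  M ≈M N = (a M ≈ a N) × (b M ≈ b N) × (c M ≈ c N) × (d M ≈ d N)

  _·_ : Mat → Mat → Mat
  M · N = mat (a M ⊗ a N ⊕ b M ⊗ c N) (a M ⊗ b N ⊕ b M ⊗ d N)
              (c M ⊗ a N ⊕ d M ⊗ c N) (c M ⊗ b N ⊕ d M ⊗ d N)
  infixl 7 _·_

  I : Mat
  I = mat 𝟙 𝟘 𝟘 𝟙

  InK : Mat → Set
  InK M = Σ Mat λ N → (M · N ≈M I) × (N · M ≈M I)

  InK₀ : ℕ → Mat → Set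
  InK₀ n M = InK M × IsUnit (a M) × IsUnit (d M)
             × (Σ ℤp λ z → c M ≈ ι (P n) ⊗ z)

  InH : Mat → Set
  InH M = (a M ≈ 𝟙) × (b M ≈ 𝟘) × (c M ≈ 𝟘)
          × (Σ ℤp λ z → d M ≈ 𝟙 ⊕ ι p ⊗ z)

  SameDoubleCoset : ℕ → Mat → Mat → Set
  SameDoubleCoset n g g' =
    Σ Mat λ k → Σ Mat λ h → InK₀ n k × InH h × (k · g · h ≈M g')

  DoubleCosetCount : ℕ → ℕ → Set
  DoubleCosetCount n N =
    Σ (Fin N → Mat) λ r →
        (∀ i → InK (r i))
      × (∀ i j → SameDoubleCoset n (r i) (r j) → i ≡ j)
      × (∀ g → InK g → ∃ λ i → SameDoubleCoset n g (r i))

CountK₀\K/H : (p : ℕ) → Prime p → ℕ → ℕ → Set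
CountK₀\K/H p pr n N = Padic.DoubleCosetCount p {{prime⇒nonZero pr}} n N

module Submission where

-- With L(x) = (1 0 ; x 1), R(y) = (0 1 ; 1 y): for g = (a b ; c d) ∈ K, if d
-- is a unit then K₀(pⁿ) g H ∋ L(c d⁻¹); otherwise c is a unit and
-- K₀(pⁿ) g H ∋ R(d c⁻¹) with d c⁻¹ ∈ pℤ_p.  The parameter matters only modulo
-- pⁿ and up to 1 + pℤ_p; these classes are {0} and those of e·p^v
-- (0 < e < p, v < n), giving 1 + n(p − 1) cosets L and 1 + (n − 1)(p − 1) R.

open import Defs
open import Data.Nat using (ℕ; zero; suc; _+_; _*_; _∸_; _≤_; _<_; NonZero; z≤n; s≤s; s≤s⁻¹; _≟_; >-nonZero⁻¹; nonTrivial⇒n>1)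
open import Data.Nat.Properties
open import Data.Nat.DivMod
open import Data.Nat.Divisibility using (_∣_; divides; n∣m⇒m%n≡0; ∣-trans; ∣1⇒≡1)
open import Data.Nat.Coprimality using (Coprime; coprime-divisor; coprime-Bézout)
open import Data.Nat.GCD using (module Bézout)
open import Data.Nat.Primality using (Prime; prime⇒nonZero; prime⇒irreducible; prime⇒nonTrivial)
import Data.Nat.Solver
open import Data.Fin using (Fin; zero; suc; toℕ; fromℕ<)
open import Data.Fin.Properties using (toℕ<n; toℕ-fromℕ<; toℕ-injective; +↔⊎; *↔×)
open import Data.Product using (Σ; ∃; _×_; _,_; proj₁; proj₂)
open import Data.Product.Function.NonDependent.Propositional using (_×-↔_)
open import Data.Sum using (_⊎_; inj₁; inj₂)
open import Data.Sum.Function.Propositional using (_⊎-↔_)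
open import Data.Empty using (⊥; ⊥-elim)
open import Data.Maybe using (Maybe; nothing; just)
open import Function.Bundles using (_↔_; mk↔ₛ′; Inverse)
open import Function.Properties.Inverse using (↔-refl; ↔-trans)
open import Relation.Nullary using (¬_; Dec; yes; no)
open import Relation.Binary.PropositionalEquality
open import Algebra.Bundles using (CommutativeRing)
open import Algebra.Structures using (IsCommutativeRing)
open import Relation.Binary.Bundles using (Setoid)
import Relation.Binary.Reasoning.Setoid as SetoidReasoning

%-absorbˡ-+ : ∀ a b Q .{{_ : NonZero Q}} → (a % Q + b) % Q ≡ (a + b) % Q
%-absorbˡ-+ a b Q = trans (%-distribˡ-+ (a % Q) b Q)
  (trans (cong (λ t → (t + b % Q) % Q) (m%n%n≡m%n a Q)) (sym (%-distribˡ-+ a b Q)))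

%-absorbʳ-+ : ∀ a b Q .{{_ : NonZero Q}} → (a + b % Q) % Q ≡ (a + b) % Q
%-absorbʳ-+ a b Q = trans (cong (_% Q) (+-comm a (b % Q)))
  (trans (%-absorbˡ-+ b a Q) (cong (_% Q) (+-comm b a)))

%-absorbˡ-* : ∀ a b Q .{{_ : NonZero Q}} → (a % Q * b) % Q ≡ (a * b) % Q
%-absorbˡ-* a b Q = trans (%-distribˡ-* (a % Q) b Q)
  (trans (cong (λ t → (t * (b % Q)) % Q) (m%n%n≡m%n a Q)) (sym (%-distribˡ-* a b Q)))

%-absorbʳ-* : ∀ a b Q .{{_ : NonZero Q}} → (a * (b % Q)) % Q ≡ (a * b) % Q
%-absorbʳ-* a b Q = trans (cong (_% Q) (*-comm a (b % Q)))
  (trans (%-absorbˡ-* b a Q) (cong (_% Q) (*-comm b a)))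

-- The identity behind the negative case of Bézout in `inverse-mod-P`.
bézout-rearrange : ∀ a x q → a * (x * q) + (1 + x * a) ≡ 1 + (a * x) * (1 + q)
bézout-rearrange = solve 3 (λ a x q → a :* (x :* q) :+ (con 1 :+ x :* a) := con 1 :+ (a :* x) :* (con 1 :+ q)) refl
  where open Data.Nat.Solver.+-*-Solver

module Counting (p : ℕ) .{{p≢0 : NonZero p}} (n : ℕ) where
  open Padic p

  count-by-labels : ∀ {N} {Label : Set} → Fin N ↔ Label → (rep : Label → Mat) →
    (∀ ℓ → InK (rep ℓ)) →
    (∀ ℓ ℓ' → SameDoubleCoset n (rep ℓ) (rep ℓ') → ℓ ≡ ℓ') →
    (∀ g → InK g → ∃ λ ℓ → SameDoubleCoset n g (rep ℓ)) →
    DoubleCosetCount n N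
  count-by-labels enum rep rep∈K separated covers =
      (λ i → rep (to i)) , (λ i → rep∈K (to i)) , separated′ , covers′
    where
    open Inverse enum
    separated′ : ∀ i j → SameDoubleCoset n (rep (to i)) (rep (to j)) → i ≡ j
    separated′ i j s = trans (sym (strictlyInverseʳ i)) (trans (cong from (separated _ _ s)) (strictlyInverseʳ j))
    covers′ : ∀ g → InK g → ∃ λ i → SameDoubleCoset n g (rep (to i))
    covers′ g g∈K with covers g g∈K
    ... | ℓ , s = from ℓ , subst (λ ℓ′ → SameDoubleCoset n g (rep ℓ′)) (sym (strictlyInverseˡ ℓ)) s

module PadicRing (p : ℕ) .{{p≢0 : NonZero p}} where
  open Padic p public

  P≢0 : ∀ k → NonZero (P k)
  P≢0 k = m^n≢0 p k

  %P-absorbˡ-+ : ∀ a b k → (a %P k + b) %P k ≡ (a + b) %P k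
  %P-absorbˡ-+ a b k = %-absorbˡ-+ a b (P k) {{P≢0 k}}

  %P-absorbʳ-+ : ∀ a b k → (a + b %P k) %P k ≡ (a + b) %P k
  %P-absorbʳ-+ a b k = %-absorbʳ-+ a b (P k) {{P≢0 k}}

  %P-absorbˡ-* : ∀ a b k → (a %P k * b) %P k ≡ (a * b) %P k
  %P-absorbˡ-* a b k = %-absorbˡ-* a b (P k) {{P≢0 k}}

  %P-absorbʳ-* : ∀ a b k → (a * (b %P k)) %P k ≡ (a * b) %P k
  %P-absorbʳ-* a b k = %-absorbʳ-* a b (P k) {{P≢0 k}}

  %P-small : ∀ {a} k → a < P k → a %P k ≡ a
  %P-small k lt = m<n⇒m%n≡m {{P≢0 k}} lt

  %P-idem : ∀ a k → a %P k %P k ≡ a %P k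
  %P-idem a k = m%n%n≡m%n a (P k) {{P≢0 k}}

  0%P : ∀ k → 0 %P k ≡ 0
  0%P k = %P-small k (m^n>0 p k)

  res-reduced : ∀ x k → res x k %P k ≡ res x k
  res-reduced x k = %P-small k (bound x k)

  fromCompatible : (f : ℕ → ℕ) → (∀ k → f (suc k) %P k ≡ f k %P k) → ℤp
  fromCompatible f c = mkℤp (λ k → f k %P k) (λ k → %P<P (f k) k)
    (λ k → trans (reduce (f (suc k)) k) (c k))

  -- Equality of p-adic integers wrapped in a record: unlike the function
  -- type x ≈ y, the record type determines x and y, so that it can serve as
  -- the equality of a setoid without unresolved implicit arguments.
  infix 4 _≋_
  record _≋_ (x y : ℤp) : Set where
    constructor ≋i
    field un : x ≈ y
  open _≋_ public

  ≋-refl : ∀ {x} → x ≋ x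
  ≋-refl = ≋i (λ k → refl)

  ≋-sym : ∀ {x y} → x ≋ y → y ≋ x
  ≋-sym (≋i e) = ≋i (λ k → sym (e k))

  ≋-trans : ∀ {x y z} → x ≋ y → y ≋ z → x ≋ z
  ≋-trans (≋i e) (≋i f) = ≋i (λ k → trans (e k) (f k))

  ≡⇒≋ : ∀ {x y} → x ≡ y → x ≋ y
  ≡⇒≋ refl = ≋-refl

  minusOne : ℤp
  minusOne = fromCompatible (λ k → P k ∸ 1) compatible
    where
    compatible : ∀ k → (P (suc k) ∸ 1) %P k ≡ (P k ∸ 1) %P k
    compatible k = trans (cong (_%P k) split) ([m+kn]%n≡m%n (P k ∸ 1) (p ∸ 1) (P k) {{P≢0 k}})
      where
      open ≡-Reasoning
      split : P (suc k) ∸ 1 ≡ (P k ∸ 1) + (p ∸ 1) * P k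
      split = begin
        p * P k ∸ 1                ≡⟨ cong (λ t → t * P k ∸ 1) (sym (m+[n∸m]≡n (>-nonZero⁻¹ p))) ⟩
        (P k + (p ∸ 1) * P k) ∸ 1  ≡⟨ +-∸-comm ((p ∸ 1) * P k) (m^n>0 p k) ⟩
        (P k ∸ 1) + (p ∸ 1) * P k  ∎

  ⊖_ : ℤp → ℤp
  ⊖ x = minusOne ⊗ x
  infix 8 ⊖_

  ⊕-cong : ∀ {x x' y y'} → x ≋ x' → y ≋ y' → x ⊕ y ≋ x' ⊕ y'
  ⊕-cong (≋i e) (≋i f) = ≋i λ k → cong₂ (λ a b → (a + b) %P k) (e k) (f k)

  ⊗-cong : ∀ {x x' y y'} → x ≋ x' → y ≋ y' → x ⊗ y ≋ x' ⊗ y'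
  ⊗-cong (≋i e) (≋i f) = ≋i λ k → cong₂ (λ a b → (a * b) %P k) (e k) (f k)

  ⊖-cong : ∀ {x x'} → x ≋ x' → ⊖ x ≋ ⊖ x'
  ⊖-cong = ⊗-cong (≋-refl {minusOne})

  ⊕-assoc : ∀ x y z → (x ⊕ y) ⊕ z ≋ x ⊕ (y ⊕ z)
  ⊕-assoc x y z = ≋i λ k → trans (%P-absorbˡ-+ (res x k + res y k) (res z k) k)
    (trans (cong (_%P k) (+-assoc (res x k) _ _)) (sym (%P-absorbʳ-+ (res x k) _ k)))

  ⊗-assoc : ∀ x y z → (x ⊗ y) ⊗ z ≋ x ⊗ (y ⊗ z)
  ⊗-assoc x y z = ≋i λ k → trans (%P-absorbˡ-* (res x k * res y k) (res z k) k)
    (trans (cong (_%P k) (*-assoc (res x k) _ _)) (sym (%P-absorbʳ-* (res x k) _ k)))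

  ⊕-comm : ∀ x y → x ⊕ y ≋ y ⊕ x
  ⊕-comm x y = ≋i λ k → cong (_%P k) (+-comm (res x k) _)

  ⊗-comm : ∀ x y → x ⊗ y ≋ y ⊗ x
  ⊗-comm x y = ≋i λ k → cong (_%P k) (*-comm (res x k) _)

  ⊕-identityˡ : ∀ x → 𝟘 ⊕ x ≋ x
  ⊕-identityˡ x = ≋i λ k → trans (cong (λ t → (t + res x k) %P k) (0%P k)) (res-reduced x k)

  ⊕-identityʳ : ∀ x → x ⊕ 𝟘 ≋ x
  ⊕-identityʳ x = ≋-trans (⊕-comm x 𝟘) (⊕-identityˡ x)

  ⊗-identityˡ : ∀ x → 𝟙 ⊗ x ≋ x
  ⊗-identityˡ x = ≋i λ k → trans (%P-absorbˡ-* 1 (res x k) k)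
    (trans (cong (_%P k) (*-identityˡ (res x k))) (res-reduced x k))

  ⊗-identityʳ : ∀ x → x ⊗ 𝟙 ≋ x
  ⊗-identityʳ x = ≋-trans (⊗-comm x 𝟙) (⊗-identityˡ x)

  ⊗-distribˡ-⊕ : ∀ x y z → x ⊗ (y ⊕ z) ≋ x ⊗ y ⊕ x ⊗ z
  ⊗-distribˡ-⊕ x y z = ≋i λ k → trans (%P-absorbʳ-* (res x k) (res y k + res z k) k)
    (trans (cong (_%P k) (*-distribˡ-+ (res x k) (res y k) _))
           (%-distribˡ-+ (res x k * res y k) _ (P k) {{P≢0 k}}))

  ⊗-distribʳ-⊕ : ∀ x y z → (y ⊕ z) ⊗ x ≋ y ⊗ x ⊕ z ⊗ x
  ⊗-distribʳ-⊕ x y z = ≋-trans (⊗-comm (y ⊕ z) x)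
    (≋-trans (⊗-distribˡ-⊕ x y z) (⊕-cong (⊗-comm x y) (⊗-comm x z)))

  ⊖-inverseʳ : ∀ x → x ⊕ ⊖ x ≋ 𝟘
  ⊖-inverseʳ x = ≋i λ k → cancel (res x k) k
    where
    -- X + (p^k − 1)X = p^k X ≡ 0
    cancel : ∀ X k → (X + ((P k ∸ 1) %P k * X) %P k) %P k ≡ 0 %P k
    cancel X k = begin
      (X + (Q1 %P k * X) %P k) %P k  ≡⟨ %P-absorbʳ-+ X _ k ⟩
      (X + Q1 %P k * X) %P k         ≡⟨ cong (λ t → (X + t * X) %P k) (%P-small k (∸-monoʳ-< {P k} {1} {0} (s≤s z≤n) (m^n>0 p k))) ⟩
      (X + Q1 * X) %P k              ≡⟨ cong (λ t → (t + Q1 * X) %P k) (sym (*-identityˡ X)) ⟩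
      (1 * X + Q1 * X) %P k          ≡⟨ cong (_%P k) (sym (*-distribʳ-+ X 1 Q1)) ⟩
      ((1 + Q1) * X) %P k            ≡⟨ cong (λ t → (t * X) %P k) (m+[n∸m]≡n (m^n>0 p k)) ⟩
      (P k * X) %P k                 ≡⟨ cong (_%P k) (*-comm (P k) X) ⟩
      (X * P k) %P k                 ≡⟨ m*n%n≡0 X (P k) {{P≢0 k}} ⟩
      0                              ≡⟨ sym (0%P k) ⟩
      0 %P k                         ∎
      where
      open ≡-Reasoning
      Q1 = P k ∸ 1

  ⊖-inverseˡ : ∀ x → ⊖ x ⊕ x ≋ 𝟘
  ⊖-inverseˡ x = ≋-trans (⊕-comm (⊖ x) x) (⊖-inverseʳ x)

  -- The ring operations handed to the solver are opaque copies of ⊕, ⊗, ⊖: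
  -- the solver then treats them as uninterpreted symbols and never unfolds
  -- the residue computations of Defs, which would make normalisation
  -- infeasible.
  opaque
    _⊞_ : ℤp → ℤp → ℤp
    x ⊞ y = x ⊕ y
    _⊠_ : ℤp → ℤp → ℤp
    x ⊠ y = x ⊗ y
    ⊟_ : ℤp → ℤp
    ⊟ x = ⊖ x
  infixl 6 _⊞_
  infixl 7 _⊠_
  infix 8 ⊟_

  opaque
    unfolding _⊞_ _⊠_ ⊟_

    ⊕≋⊞ : ∀ x y → x ⊕ y ≋ x ⊞ y
    ⊕≋⊞ x y = ≋-refl

    ⊗≋⊠ : ∀ x y → x ⊗ y ≋ x ⊠ y
    ⊗≋⊠ x y = ≋-refl

    res-⊞ : ∀ x y k → res (x ⊞ y) k ≡ (res x k + res y k) %P k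
    res-⊞ x y k = refl

    res-⊠ : ∀ x y k → res (x ⊠ y) k ≡ (res x k * res y k) %P k
    res-⊠ x y k = refl

    ℤp-isCommutativeRing : IsCommutativeRing _≋_ _⊞_ _⊠_ ⊟_ 𝟘 𝟙
    ℤp-isCommutativeRing = record
      { isRing = record
        { +-isAbelianGroup = record
          { isGroup = record
            { isMonoid = record
              { isSemigroup = record
                { isMagma = record
                  { isEquivalence = record { refl = ≋-refl ; sym = ≋-sym ; trans = ≋-trans }
                  ; ∙-cong = ⊕-cong }
                ; assoc = ⊕-assoc }
              ; identity = ⊕-identityˡ , ⊕-identityʳ }
            ; inverse = ⊖-inverseˡ , ⊖-inverseʳ
            ; ⁻¹-cong = ⊖-cong }
          ; comm = ⊕-comm }
        ; *-cong = ⊗-cong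
        ; *-assoc = ⊗-assoc
        ; *-identity = ⊗-identityˡ , ⊗-identityʳ
        ; distrib = ⊗-distribˡ-⊕ , ⊗-distribʳ-⊕ }
      ; *-comm = ⊗-comm }

  ℤpRing : CommutativeRing _ _
  ℤpRing = record { isCommutativeRing = ℤp-isCommutativeRing }
  module ZR = CommutativeRing ℤpRing

  open import Algebra.Properties.Semiring.Mult (CommutativeRing.semiring ℤpRing) using () renaming (_×_ to _×ᵤ_)

  decideNumeral : ∀ m n → Maybe (m ×ᵤ 𝟙 ≋ n ×ᵤ 𝟙)
  decideNumeral m n with m ≟ n
  ... | yes refl = just ≋-refl
  ... | no _ = nothing

  open import Algebra.Solver.Ring.NaturalCoefficients (CommutativeRing.commutativeSemiring ℤpRing) decideNumeral public

  module ≋-Reasoning = SetoidReasoning ZR.setoid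

  P-+ : ∀ j k → P (j + k) ≡ P j * P k
  P-+ j k = ^-distribˡ-+-* p j k

  %P-%P : ∀ o j k → o %P (j + k) %P k ≡ o %P k
  %P-%P o j k = m∣n⇒o%n%m≡o%m (P k) (P (j + k)) o {{P≢0 k}} {{P≢0 (j + k)}} (divides (P j) (P-+ j k))

  res-deeper : ∀ x j k → res x (j + k) %P k ≡ res x k
  res-deeper x zero k = res-reduced x k
  res-deeper x (suc j) k = trans (sym (%P-%P (res x (suc (j + k))) j k))
    (trans (cong (_%P k) (coh x (j + k))) (res-deeper x j k))

  ι-* : ∀ a b → ι (a * b) ≋ ι a ⊠ ι b
  ι-* a b = ≋i λ k → trans (*%P a b k) (sym (res-⊠ (ι a) (ι b) k))

  res-P-multiple : ∀ j k z → res (ι (P (j + k)) ⊠ z) k ≡ 0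
  res-P-multiple j k z = begin
      res (ι (P (j + k)) ⊠ z) k          ≡⟨ res-⊠ (ι (P (j + k))) z k ⟩
      (P (j + k) %P k * res z k) %P k    ≡⟨ %P-absorbˡ-* (P (j + k)) (res z k) k ⟩
      (P (j + k) * res z k) %P k         ≡⟨ cong (λ t → (t * res z k) %P k) (P-+ j k) ⟩
      (P j * P k * res z k) %P k         ≡⟨ cong (_%P k) (*-comm (P j * P k) (res z k)) ⟩
      (res z k * (P j * P k)) %P k       ≡⟨ cong (_%P k) (sym (*-assoc (res z k) (P j) (P k))) ⟩
      (res z k * P j * P k) %P k         ≡⟨ m*n%n≡0 (res z k * P j) (P k) {{P≢0 k}} ⟩
      0                                  ∎
    where open ≡-Reasoning

  res-P-multiple-≤ : ∀ m t → t ≤ m → ∀ z → res (ι (P m) ⊠ z) t ≡ 0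
  res-P-multiple-≤ m t t≤m z with m≤n⇒∃[o]m+o≡n t≤m
  ... | o , refl = subst (λ w → res (ι (P w) ⊠ z) t ≡ 0) (+-comm o t) (res-P-multiple o t z)

  -- … and conversely an element vanishing at level m is divisible by p^m:
  -- the quotient has residues res x (k + m) / p^m.
  divide-by-P : ∀ m x → res x m ≡ 0 → Σ ℤp λ z → x ≋ ι (P m) ⊠ z
  divide-by-P m x x≡0 = z , ≋i x≡P^m*z
    where
    open ≡-Reasoning
    instance
      P^m≢0 : NonZero (P m)
      P^m≢0 = P≢0 m
    y : ℕ → ℕ
    y k = res x (k + m)
    f : ℕ → ℕ
    f k = y k / P m
    y≡f*P^m : ∀ k → y k ≡ f k * P m
    y≡f*P^m k = trans (m≡m%n+[m/n]*n (y k) (P m))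
      (cong (_+ f k * P m) (trans (res-deeper x k m) x≡0))
    f-compatible : ∀ k → f k ≡ f (suc k) %P k
    f-compatible k = *-cancelʳ-≡ (f k) (f (suc k) %P k) (P m) (begin
        f k * P m                         ≡⟨ sym (y≡f*P^m k) ⟩
        y k                               ≡⟨ sym (coh x (k + m)) ⟩
        y (suc k) %P (k + m)              ≡⟨ cong (_%P (k + m)) (y≡f*P^m (suc k)) ⟩
        (f (suc k) * P m) %P (k + m)      ≡⟨ %-congʳ {{P≢0 (k + m)}} (P-+ k m) ⟩
        (f (suc k) * P m) % (P k * P m)   ≡⟨ sym (m%n*o≡m*o%[n*o] (f (suc k)) (P k) (P m) {{P≢0 k}}) ⟩
        f (suc k) %P k * P m              ∎)
      where
      instance
        P^k*P^m≢0 : NonZero (P k * P m)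
        P^k*P^m≢0 = m*n≢0 (P k) (P m) {{P≢0 k}}
    z : ℤp
    z = fromCompatible f (λ k → trans (sym (%P-idem (f (suc k)) k)) (cong (_%P k) (sym (f-compatible k))))
    x≡P^m*z : ∀ k → res x k ≡ res (ι (P m) ⊠ z) k
    x≡P^m*z k = begin
       res x k                               ≡⟨ sym (res-deeper x m k) ⟩
       res x (m + k) %P k                    ≡⟨ cong (λ t → res x t %P k) (+-comm m k) ⟩
       y k %P k                              ≡⟨ cong (_%P k) (trans (y≡f*P^m k) (*-comm (f k) (P m))) ⟩
       (P m * f k) %P k                      ≡⟨ sym (%P-absorbˡ-* (P m) (f k) k) ⟩
       (P m %P k * f k) %P k                 ≡⟨ sym (%P-absorbʳ-* (P m %P k) (f k) k) ⟩
       (P m %P k * (f k %P k)) %P k          ≡⟨ sym (res-⊠ (ι (P m)) z k) ⟩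
       res (ι (P m) ⊠ z) k                   ∎

  res-⊠-zeroˡ : ∀ x u k → res x k ≡ 0 → res (x ⊠ u) k ≡ 0
  res-⊠-zeroˡ x u k e = trans (res-⊠ x u k) (trans (cong (λ t → (t * res u k) %P k) e) (0%P k))

  res-⊠-zeroʳ : ∀ u x k → res x k ≡ 0 → res (u ⊠ x) k ≡ 0
  res-⊠-zeroʳ u x k e = trans (res-⊠ u x k)
    (trans (cong (λ t → (res u k * t) %P k) e) (trans (cong (_%P k) (*-zeroʳ (res u k))) (0%P k)))

  res-⊞-zeroʳ : ∀ a b k → res b k ≡ 0 → res (a ⊞ b) k ≡ res a k
  res-⊞-zeroʳ a b k e = trans (res-⊞ a b k)
    (trans (cong (λ t → (res a k + t) %P k) e) (trans (cong (_%P k) (+-identityʳ (res a k))) (res-reduced a k)))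

  res-⊞-P-multiple : ∀ m t x s → t ≤ m → res (x ⊞ ι (P m) ⊠ s) t ≡ res x t
  res-⊞-P-multiple m t x s t≤m = res-⊞-zeroʳ x (ι (P m) ⊠ s) t (res-P-multiple-≤ m t t≤m s)

  res-⊟-cancel : ∀ x y k → res x k ≡ res y k → res (x ⊞ ⊟ y) k ≡ 0
  res-⊟-cancel x y k e = begin
      res (x ⊞ ⊟ y) k                      ≡⟨ res-⊞ x (⊟ y) k ⟩
      (res x k + res (⊟ y) k) %P k         ≡⟨ cong (λ t → (t + res (⊟ y) k) %P k) e ⟩
      (res y k + res (⊟ y) k) %P k         ≡⟨ sym (res-⊞ y (⊟ y) k) ⟩
      res (y ⊞ ⊟ y) k                      ≡⟨ un (ZR.-‿inverseʳ y) k ⟩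
      0 %P k                               ≡⟨ 0%P k ⟩
      0                                    ∎
    where open ≡-Reasoning

  -- 2×2 matrices over ℤ_p.  Products are recomputed with ⊞, ⊠ (`_∙_`) so
  -- that identities between entries are left to the ring solver.
  infix 4 _≋M_
  record _≋M_ (M N : Mat) : Set where
    constructor mq
    field
      qa : a M ≋ a N
      qb : b M ≋ b N
      qc : c M ≋ c N
      qd : d M ≋ d N
  open _≋M_ public

  ≋M⇒≈M : ∀ {M N} → M ≋M N → M ≈M N
  ≋M⇒≈M (mq x y z w) = un x , un y , un z , un w

  ≈M⇒≋M : ∀ {M N} → M ≈M N → M ≋M N
  ≈M⇒≋M (x , y , z , w) = mq (≋i x) (≋i y) (≋i z) (≋i w)

  ≋M-refl : ∀ {M} → M ≋M M
  ≋M-refl = mq ≋-refl ≋-refl ≋-refl ≋-refl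

  ≋M-sym : ∀ {M N} → M ≋M N → N ≋M M
  ≋M-sym (mq x y z w) = mq (≋-sym x) (≋-sym y) (≋-sym z) (≋-sym w)

  ≋M-trans : ∀ {M N L} → M ≋M N → N ≋M L → M ≋M L
  ≋M-trans (mq x y z w) (mq x' y' z' w') = mq (≋-trans x x') (≋-trans y y') (≋-trans z z') (≋-trans w w')

  Mat-setoid : Setoid _ _
  Mat-setoid = record { Carrier = Mat ; _≈_ = _≋M_
                      ; isEquivalence = record { refl = ≋M-refl ; sym = ≋M-sym ; trans = ≋M-trans } }
  module ≋M-Reasoning = SetoidReasoning Mat-setoid

  _∙_ : Mat → Mat → Mat
  M ∙ N = mat (a M ⊠ a N ⊞ b M ⊠ c N) (a M ⊠ b N ⊞ b M ⊠ d N)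
              (c M ⊠ a N ⊞ d M ⊠ c N) (c M ⊠ b N ⊞ d M ⊠ d N)
  infixl 7 _∙_

  ·≋∙ : ∀ M N → M · N ≋M M ∙ N
  ·≋∙ M N = mq (entry (a M) (a N) (b M) (c N)) (entry (a M) (b N) (b M) (d N))
               (entry (c M) (a N) (d M) (c N)) (entry (c M) (b N) (d M) (d N))
    where
    entry : ∀ x y z w → x ⊗ y ⊕ z ⊗ w ≋ x ⊠ y ⊞ z ⊠ w
    entry x y z w = ≋-trans (⊕≋⊞ (x ⊗ y) (z ⊗ w)) (ZR.+-cong (⊗≋⊠ x y) (⊗≋⊠ z w))

  ∙-cong : ∀ {M M' N N'} → M ≋M M' → N ≋M N' → M ∙ N ≋M M' ∙ N'
  ∙-cong (mq a1 b1 c1 d1) (mq a2 b2 c2 d2) =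
    mq (ZR.+-cong (ZR.*-cong a1 a2) (ZR.*-cong b1 c2)) (ZR.+-cong (ZR.*-cong a1 b2) (ZR.*-cong b1 d2))
       (ZR.+-cong (ZR.*-cong c1 a2) (ZR.*-cong d1 c2)) (ZR.+-cong (ZR.*-cong c1 b2) (ZR.*-cong d1 d2))

  ·≋∙∙ : ∀ M N L → M · N · L ≋M M ∙ N ∙ L
  ·≋∙∙ M N L = ≋M-trans (·≋∙ (M · N) L) (∙-cong (·≋∙ M N) ≋M-refl)

  ∙-assoc : ∀ M N L → (M ∙ N) ∙ L ≋M M ∙ (N ∙ L)
  ∙-assoc (mat a1 b1 c1 d1) (mat a2 b2 c2 d2) (mat a3 b3 c3 d3) =
    mq (row a1 b1 a2 b2 c2 d2 a3 c3) (row a1 b1 a2 b2 c2 d2 b3 d3)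
       (row c1 d1 a2 b2 c2 d2 a3 c3) (row c1 d1 a2 b2 c2 d2 b3 d3)
    where
    row : ∀ x y a b c d u v → (x ⊠ a ⊞ y ⊠ c) ⊠ u ⊞ (x ⊠ b ⊞ y ⊠ d) ⊠ v ≋ x ⊠ (a ⊠ u ⊞ b ⊠ v) ⊞ y ⊠ (c ⊠ u ⊞ d ⊠ v)
    row = solve 8 (λ x y a b c d u v → (x :* a :+ y :* c) :* u :+ (x :* b :+ y :* d) :* v
                                       := x :* (a :* u :+ b :* v) :+ y :* (c :* u :+ d :* v)) ≋-refl

  ∙-identityˡ : ∀ M → I ∙ M ≋M M
  ∙-identityˡ (mat a1 b1 c1 d1) = mq (top a1 c1) (top b1 d1) (bottom a1 c1) (bottom b1 d1)
    where
    top : ∀ x y → 𝟙 ⊠ x ⊞ 𝟘 ⊠ y ≋ x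
    top = solve 2 (λ x y → con 1 :* x :+ con 0 :* y := x) ≋-refl
    bottom : ∀ x y → 𝟘 ⊠ x ⊞ 𝟙 ⊠ y ≋ y
    bottom = solve 2 (λ x y → con 0 :* x :+ con 1 :* y := y) ≋-refl

  ∙-identityʳ : ∀ M → M ∙ I ≋M M
  ∙-identityʳ (mat a1 b1 c1 d1) = mq (left a1 b1) (right a1 b1) (left c1 d1) (right c1 d1)
    where
    left : ∀ x y → x ⊠ 𝟙 ⊞ y ⊠ 𝟘 ≋ x
    left = solve 2 (λ x y → x :* con 1 :+ y :* con 0 := x) ≋-refl
    right : ∀ x y → x ⊠ 𝟘 ⊞ y ⊠ 𝟙 ≋ y
    right = solve 2 (λ x y → x :* con 0 :+ y :* con 1 := y) ≋-refl

  Invertible₂ : Mat → Set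
  Invertible₂ M = Σ Mat λ N → (M ∙ N ≋M I) × (N ∙ M ≋M I)

  Invertible₂⇒InK : ∀ {M} → Invertible₂ M → InK M
  Invertible₂⇒InK {M} (N , e , f) = N , ≋M⇒≈M (≋M-trans (·≋∙ M N) e) , ≋M⇒≈M (≋M-trans (·≋∙ N M) f)

  InK⇒Invertible₂ : ∀ {M} → InK M → Invertible₂ M
  InK⇒Invertible₂ {M} (N , e , f) = N , ≋M-trans (≋M-sym (·≋∙ M N)) (≈M⇒≋M e) , ≋M-trans (≋M-sym (·≋∙ N M)) (≈M⇒≋M f)

  Invertible₂-∙ : ∀ {A B} → Invertible₂ A → Invertible₂ B → Invertible₂ (A ∙ B)
  Invertible₂-∙ {A} {B} (A' , e , e') (B' , f , f') = B' ∙ A' , cancel A B A' B' e f , cancel B' A' B A f' e'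
    where
    cancel : ∀ A B A' B' → A ∙ A' ≋M I → B ∙ B' ≋M I → (A ∙ B) ∙ (B' ∙ A') ≋M I
    cancel A B A' B' e f =
      ≋M-trans (∙-assoc A B (B' ∙ A'))
      (≋M-trans (∙-cong (≋M-refl {A}) (≋M-sym (∙-assoc B B' A')))
      (≋M-trans (∙-cong (≋M-refl {A}) (∙-cong f (≋M-refl {A'})))
      (≋M-trans (∙-cong (≋M-refl {A}) (∙-identityˡ A')) e)))

  L : ℤp → Mat
  L x = mat 𝟙 𝟘 x 𝟙

  L-invertible : ∀ x → Invertible₂ (L x)
  L-invertible x = L (⊟ x) , L-∙ x (⊟ x) (ZR.-‿inverseʳ x) , L-∙ (⊟ x) x (ZR.-‿inverseˡ x)
    where
    L-∙ : ∀ x y → x ⊞ y ≋ 𝟘 → L x ∙ L y ≋M I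
    L-∙ x y x+y≋0 = mq (solve 1 (λ y → con 1 :* con 1 :+ con 0 :* y := con 1) ≋-refl y)
                       (solve 0 (con 1 :* con 0 :+ con 0 :* con 1 := con 0) ≋-refl)
                       (≋-trans (solve 2 (λ x y → x :* con 1 :+ con 1 :* y := x :+ y) ≋-refl x y) x+y≋0)
                       (solve 1 (λ x → x :* con 0 :+ con 1 :* con 1 := con 1) ≋-refl x)

  R : ℤp → Mat
  R y = mat 𝟘 𝟙 𝟙 y

  R-invertible : ∀ y → Invertible₂ (R y)
  R-invertible y = mat (⊟ y) 𝟙 𝟙 𝟘 ,
     mq (solve 1 (λ m → con 0 :* m :+ con 1 :* con 1 := con 1) ≋-refl (⊟ y))
        (solve 0 (con 0 :* con 1 :+ con 1 :* con 0 := con 0) ≋-refl)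
        (≋-trans (solve 2 (λ m y → con 1 :* m :+ y :* con 1 := m :+ y) ≋-refl (⊟ y) y) (ZR.-‿inverseˡ y))
        (solve 1 (λ y → con 1 :* con 1 :+ y :* con 0 := con 1) ≋-refl y) ,
     mq (solve 1 (λ m → m :* con 0 :+ con 1 :* con 1 := con 1) ≋-refl (⊟ y))
        (≋-trans (solve 2 (λ m y → m :* con 1 :+ con 1 :* y := m :+ y) ≋-refl (⊟ y) y) (ZR.-‿inverseˡ y))
        (solve 0 (con 1 :* con 0 :+ con 0 :* con 1 := con 0) ≋-refl)
        (solve 1 (λ y → con 1 :* con 1 :+ con 0 :* y := con 1) ≋-refl y)

  D : ℤp → Mat
  D w = mat 𝟙 𝟘 𝟘 w

  D-∙ : ∀ w v → w ⊠ v ≋ 𝟙 → D w ∙ D v ≋M I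
  D-∙ w v wv≋1 = mq (solve 0 (con 1 :* con 1 :+ con 0 :* con 0 := con 1) ≋-refl)
                    (solve 1 (λ v → con 1 :* con 0 :+ con 0 :* v := con 0) ≋-refl v)
                    (solve 1 (λ w → con 0 :* con 1 :+ w :* con 0 := con 0) ≋-refl w)
                    (≋-trans (solve 2 (λ w v → con 0 :* con 0 :+ w :* v := w :* v) ≋-refl w v) wv≋1)

  D-invertible : ∀ w v → w ⊠ v ≋ 𝟙 → Invertible₂ (D w)
  D-invertible w v wv≋1 = D v , D-∙ w v wv≋1 , D-∙ v w (≋-trans (ZR.*-comm v w) wv≋1)

  module Units (pr : Prime p) where
    p>1 : 1 < p
    p>1 = nonTrivial⇒n>1 p {{prime⇒nonTrivial pr}}

    P1≡p : P 1 ≡ p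
    P1≡p = *-identityʳ p

    %P1≡%p : ∀ a → a %P 1 ≡ a % p
    %P1≡%p a = %-congʳ {{P≢0 1}} P1≡p

    1%P1≡1 : 1 %P 1 ≡ 1
    1%P1≡1 = %P-small 1 (subst (1 <_) (sym P1≡p) p>1)

    coprime-P : ∀ a → ¬ (p ∣ a) → ∀ k → Coprime a (P k)
    coprime-P a p∤a zero (d∣a , d∣1) = ∣1⇒≡1 d∣1
    coprime-P a p∤a (suc k) {d} (d∣a , d∣pP) = coprime-P a p∤a k (d∣a , coprime-divisor d⊥p d∣pP)
      where
      d⊥p : Coprime d p
      d⊥p {e} (e∣d , e∣p) with prime⇒irreducible pr e∣p
      ... | inj₁ e≡1 = e≡1
      ... | inj₂ refl = ⊥-elim (p∤a (∣-trans e∣d d∣a))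

    inverse-mod-P : ∀ a k → ¬ (p ∣ a) → Σ ℕ λ t → (a * t) %P k ≡ 1 %P k
    inverse-mod-P a zero _ = 0 , trans (n%1≡0 (a * 0)) (sym (n%1≡0 1))
    inverse-mod-P a (suc k) p∤a with coprime-Bézout (coprime-P a p∤a (suc k))
    ... | Bézout.+- x y eq = x , (begin
           (a * x) %P suc k             ≡⟨ cong (_%P suc k) (trans (*-comm a x) (sym eq)) ⟩
           (1 + y * Q) %P suc k         ≡⟨ [m+kn]%n≡m%n 1 y Q {{P≢0 (suc k)}} ⟩
           1 %P suc k                   ∎)
      where
      open ≡-Reasoning
      Q = P (suc k)
    ... | Bézout.-+ x y eq = x * (Q ∸ 1) , (begin
           (a * (x * (Q ∸ 1))) %P suc k                   ≡⟨ sym ([m+kn]%n≡m%n (a * (x * (Q ∸ 1))) y Q {{P≢0 (suc k)}}) ⟩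
           (a * (x * (Q ∸ 1)) + y * Q) %P suc k           ≡⟨ cong (λ t → (a * (x * (Q ∸ 1)) + t) %P suc k) (sym eq) ⟩
           (a * (x * (Q ∸ 1)) + (1 + x * a)) %P suc k     ≡⟨ cong (_%P suc k) (bézout-rearrange a x (Q ∸ 1)) ⟩
           (1 + (a * x) * (1 + (Q ∸ 1))) %P suc k         ≡⟨ cong (λ t → (1 + (a * x) * t) %P suc k) (m+[n∸m]≡n (m^n>0 p (suc k))) ⟩
           (1 + (a * x) * Q) %P suc k                     ≡⟨ [m+kn]%n≡m%n 1 (a * x) Q {{P≢0 (suc k)}} ⟩
           1 %P suc k                                     ∎)
      where
      open ≡-Reasoning
      Q = P (suc k)

    inverse-mod-P-unique : ∀ a s s' k → s < P k → s' < P k →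
      (a * s) %P k ≡ 1 %P k → (a * s') %P k ≡ 1 %P k → s ≡ s'
    inverse-mod-P-unique a s s' k s<P s'<P as≡1 as'≡1 = begin
        s                                ≡⟨ sym (%P-small k s<P) ⟩
        s %P k                           ≡⟨ cong (_%P k) (sym (*-identityʳ s)) ⟩
        (s * 1) %P k                     ≡⟨ sym (%P-absorbʳ-* s 1 k) ⟩
        (s * (1 %P k)) %P k              ≡⟨ cong (λ t → (s * t) %P k) (sym as'≡1) ⟩
        (s * ((a * s') %P k)) %P k       ≡⟨ %P-absorbʳ-* s (a * s') k ⟩
        (s * (a * s')) %P k              ≡⟨ cong (_%P k) (trans (sym (*-assoc s a s')) (cong (_* s') (*-comm s a))) ⟩
        (a * s * s') %P k                ≡⟨ sym (%P-absorbˡ-* (a * s) s' k) ⟩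
        ((a * s) %P k * s') %P k         ≡⟨ cong (λ t → (t * s') %P k) as≡1 ⟩
        (1 %P k * s') %P k               ≡⟨ %P-absorbˡ-* 1 s' k ⟩
        (1 * s') %P k                    ≡⟨ cong (_%P k) (*-identityˡ s') ⟩
        s' %P k                          ≡⟨ %P-small k s'<P ⟩
        s'                               ∎
      where open ≡-Reasoning

    Invertible : ℤp → Set
    Invertible x = Σ ℤp λ y → x ⊠ y ≋ 𝟙

    Invertible⇒IsUnit : ∀ {x} → Invertible x → IsUnit x
    Invertible⇒IsUnit {x} (y , e) = y , un (≋-trans (⊗≋⊠ x y) e)

    IsUnit⇒Invertible : ∀ {x} → IsUnit x → Invertible x
    IsUnit⇒Invertible {x} (y , e) = y , ≋-trans (≋-sym (⊗≋⊠ x y)) (≋i e)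

    -- The unit criterion: p ∤ x implies x ∈ ℤ_p^×.  The inverse has as
    -- residues the inverses modulo p^k, compatible by uniqueness.
    unit-criterion : ∀ x → res x 1 ≢ 0 → Invertible x
    unit-criterion x x≢0 = x⁻¹ , ≋i λ k → trans (res-⊠ x x⁻¹ k) (trans (%P-absorbʳ-* (res x k) (t k) k) (t-inverse k))
      where
      p∤res : ∀ k → ¬ (p ∣ res x (suc k))
      p∤res k p∣ = x≢0 (begin
        res x 1                    ≡⟨ sym (res-deeper x k 1) ⟩
        res x (k + 1) %P 1         ≡⟨ cong (λ t → res x t %P 1) (+-comm k 1) ⟩
        res x (suc k) %P 1         ≡⟨ %P1≡%p (res x (suc k)) ⟩
        res x (suc k) % p          ≡⟨ n∣m⇒m%n≡0 (res x (suc k)) p p∣ ⟩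
        0                          ∎)
        where open ≡-Reasoning
      inverses : ∀ k → Σ ℕ λ t → (res x k * t) %P k ≡ 1 %P k
      inverses zero = 0 , trans (n%1≡0 (res x 0 * 0)) (sym (n%1≡0 1))
      inverses (suc k) = inverse-mod-P (res x (suc k)) (suc k) (p∤res k)
      t : ℕ → ℕ
      t k = proj₁ (inverses k)
      t-inverse : ∀ k → (res x k * t k) %P k ≡ 1 %P k
      t-inverse k = proj₂ (inverses k)
      t-compatible : ∀ k → t (suc k) %P k ≡ t k %P k
      t-compatible k = inverse-mod-P-unique (res x k) _ _ k (%P<P _ k) (%P<P _ k) lifted
                         (trans (%P-absorbʳ-* (res x k) (t k) k) (t-inverse k))
        where
        open ≡-Reasoning
        lifted : (res x k * (t (suc k) %P k)) %P k ≡ 1 %P k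
        lifted = begin
          (res x k * (t (suc k) %P k)) %P k               ≡⟨ %P-absorbʳ-* (res x k) _ k ⟩
          (res x k * t (suc k)) %P k                      ≡⟨ cong (λ u → (u * t (suc k)) %P k) (sym (coh x k)) ⟩
          (res x (suc k) %P k * t (suc k)) %P k           ≡⟨ %P-absorbˡ-* (res x (suc k)) _ k ⟩
          (res x (suc k) * t (suc k)) %P k                ≡⟨ sym (%P-%P _ 1 k) ⟩
          (res x (suc k) * t (suc k)) %P suc k %P k       ≡⟨ cong (_%P k) (t-inverse (suc k)) ⟩
          1 %P suc k %P k                                 ≡⟨ %P-%P 1 1 k ⟩
          1 %P k                                          ∎
      x⁻¹ : ℤp
      x⁻¹ = fromCompatible t t-compatible

    res-≡0-≉𝟙 : ∀ x → res x 1 ≡ 0 → x ≋ 𝟙 → ⊥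
    res-≡0-≉𝟙 x x≡0 (≋i x≈1) = 0≢1+n (trans (sym x≡0) (trans (x≈1 1) 1%P1≡1))

    Invertible⇒res≢0 : ∀ x → Invertible x → res x 1 ≢ 0
    Invertible⇒res≢0 x (y , xy≋1) x≡0 = res-≡0-≉𝟙 (x ⊠ y) (res-⊠-zeroˡ x y 1 x≡0) xy≋1

    res-≡0-combination : ∀ x y u v → res x 1 ≡ 0 → res y 1 ≡ 0 → x ⊠ u ⊞ y ⊠ v ≋ 𝟙 → ⊥
    res-≡0-combination x y u v x≡0 y≡0 = res-≡0-≉𝟙 (x ⊠ u ⊞ y ⊠ v)
      (trans (res-⊞-zeroʳ (x ⊠ u) (y ⊠ v) 1 (res-⊠-zeroˡ y v 1 y≡0)) (res-⊠-zeroˡ x u 1 x≡0))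

    res-⊠-≡1 : ∀ x u → res u 1 ≡ 1 → res (x ⊠ u) 1 ≡ res x 1
    res-⊠-≡1 x u u≡1 = trans (res-⊠ x u 1)
      (trans (cong (λ t → (res x 1 * t) %P 1) u≡1) (trans (cong (_%P 1) (*-identityʳ (res x 1))) (res-reduced x 1)))

    inverse-≡1 : ∀ x u → res u 1 ≡ 1 → x ⊠ u ≋ 𝟙 → res x 1 ≡ 1
    inverse-≡1 x u u≡1 xu≋1 = trans (sym (res-⊠-≡1 x u u≡1)) (trans (un xu≋1 1) 1%P1≡1)

    ≡1⇒∈1+pℤp : ∀ w → res w 1 ≡ 1 → Σ ℤp λ z → w ≈ 𝟙 ⊕ ι p ⊗ z
    ≡1⇒∈1+pℤp w w≡1 = z , λ k → trans (un w≋1+pz k) (sym (un defs-form k))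
      where
      open ≋-Reasoning
      quotient : Σ ℤp λ z → w ⊞ ⊟ 𝟙 ≋ ι (P 1) ⊠ z
      quotient = divide-by-P 1 (w ⊞ ⊟ 𝟙) (res-⊟-cancel w 𝟙 1 (trans w≡1 (sym 1%P1≡1)))
      z = proj₁ quotient
      w≋1+pz : w ≋ 𝟙 ⊞ ι p ⊠ z
      w≋1+pz = begin
        w                     ≈⟨ ZR.+-identityʳ w ⟨
        w ⊞ 𝟘                 ≈⟨ ZR.+-congˡ (ZR.-‿inverseʳ 𝟙) ⟨
        w ⊞ (𝟙 ⊞ ⊟ 𝟙)         ≈⟨ solve 2 (λ w m → w :+ (con 1 :+ m) := con 1 :+ (w :+ m)) ≋-refl w (⊟ 𝟙) ⟩
        𝟙 ⊞ (w ⊞ ⊟ 𝟙)         ≈⟨ ZR.+-congˡ (proj₂ quotient) ⟩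
        𝟙 ⊞ ι (P 1) ⊠ z       ≈⟨ ZR.+-congˡ (ZR.*-congʳ (≡⇒≋ (cong ι P1≡p))) ⟩
        𝟙 ⊞ ι p ⊠ z           ∎
      defs-form : 𝟙 ⊕ ι p ⊗ z ≋ 𝟙 ⊞ ι p ⊠ z
      defs-form = ≋-trans (⊕≋⊞ 𝟙 (ι p ⊗ z)) (ZR.+-congˡ (⊗≋⊠ (ι p) z))

    ∈1+pℤp⇒≡1 : ∀ w z → w ≈ 𝟙 ⊕ ι p ⊗ z → res w 1 ≡ 1
    ∈1+pℤp⇒≡1 w z w≈1+pz = begin
        res w 1                       ≡⟨ w≈1+pz 1 ⟩
        res (𝟙 ⊕ ι p ⊗ z) 1           ≡⟨ un (≋-trans (⊕≋⊞ 𝟙 (ι p ⊗ z)) (ZR.+-congˡ (≋-trans (⊗≋⊠ (ι p) z) p≋P1))) 1 ⟩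
        res (𝟙 ⊞ ι (P 1) ⊠ z) 1       ≡⟨ res-⊞-P-multiple 1 1 𝟙 z ≤-refl ⟩
        res 𝟙 1                       ≡⟨ 1%P1≡1 ⟩
        1                             ∎
      where
      open ≡-Reasoning
      p≋P1 : ι p ⊠ z ≋ ι (P 1) ⊠ z
      p≋P1 = ZR.*-congʳ (≡⇒≋ (cong ι (sym P1≡p)))

    module UnitOrbits (n : ℕ) where
      Pn : ℤp
      Pn = ι (P n)

      -- A ≡ u·B (mod pⁿ) for some u ≡ 1 (mod p), read off residue by residue.
      Associated : ℕ → ℕ → Set
      Associated A B = Σ ℤp λ u → res u 1 ≡ 1 × (∀ t → t ≤ n → A %P t ≡ res (u ⊠ ι B) t)

      associated-fromʳ : ∀ A B u s → res u 1 ≡ 1 → ι A ≋ u ⊠ ι B ⊞ Pn ⊠ s → Associated A B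
      associated-fromʳ A B u s u≡1 A≋uB+pⁿs =
        u , u≡1 , λ t t≤n → trans (un A≋uB+pⁿs t) (res-⊞-P-multiple n t (u ⊠ ι B) s t≤n)

      associated-fromˡ : ∀ A B u s → res u 1 ≡ 1 → ι A ⊞ Pn ⊠ s ≋ u ⊠ ι B → Associated A B
      associated-fromˡ A B u s u≡1 A+pⁿs≋uB =
        u , u≡1 , λ t t≤n → trans (sym (res-⊞-P-multiple n t (ι A) s t≤n)) (un A+pⁿs≋uB t)

      E*P-positive : ∀ E V → 0 < E → 0 < E * P V
      E*P-positive E V E>0 = <-≤-trans (m^n>0 p V) (subst (_≤ E * P V) (*-identityˡ (P V)) (*-monoˡ-≤ (P V) E>0))

      E*P-vanishes : ∀ E V t → t ≤ V → (E * P V) %P t ≡ 0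
      E*P-vanishes E V t t≤V with m≤n⇒∃[o]m+o≡n t≤V
      ... | o , refl = begin
          (E * P (t + o)) %P t     ≡⟨ cong (λ w → (E * P w) %P t) (+-comm t o) ⟩
          (E * P (o + t)) %P t     ≡⟨ cong (λ w → (E * w) %P t) (P-+ o t) ⟩
          (E * (P o * P t)) %P t   ≡⟨ cong (_%P t) (sym (*-assoc E (P o) (P t))) ⟩
          (E * P o * P t) %P t     ≡⟨ m*n%n≡0 (E * P o) (P t) {{P≢0 t}} ⟩
          0                        ∎
        where open ≡-Reasoning

      -- An association of E·p^V, read at level V + 1 where E·p^V is reduced.
      associated-at : ∀ E V B → E < p → V < n → (α : Associated (E * P V) B) →
                      E * P V ≡ (res (proj₁ α) (suc V) * (B %P suc V)) %P suc V
      associated-at E V B E<p V<n (u , _ , α) = begin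
          E * P V                                  ≡⟨ sym (%P-small (suc V) (*-monoˡ-< (P V) {{P≢0 V}} E<p)) ⟩
          (E * P V) %P suc V                       ≡⟨ α (suc V) V<n ⟩
          res (u ⊠ ι B) (suc V)                    ≡⟨ res-⊠ u (ι B) (suc V) ⟩
          (res u (suc V) * (B %P suc V)) %P suc V  ∎
        where open ≡-Reasoning

      not-associated-deeper : ∀ E V B → 0 < E → E < p → V < n → B %P suc V ≡ 0 → ¬ Associated (E * P V) B
      not-associated-deeper E V B E>0 E<p V<n B≡0 α = <⇒≢ (E*P-positive E V E>0) (sym (begin
          E * P V                                   ≡⟨ associated-at E V B E<p V<n α ⟩
          (res (proj₁ α) (suc V) * (B %P suc V)) %P suc V ≡⟨ cong (λ t → (res (proj₁ α) (suc V) * t) %P suc V) B≡0 ⟩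
          (res (proj₁ α) (suc V) * 0) %P suc V      ≡⟨ cong (_%P suc V) (*-zeroʳ (res (proj₁ α) (suc V))) ⟩
          0 %P suc V                                ≡⟨ 0%P (suc V) ⟩
          0                                         ∎))
        where open ≡-Reasoning

      res-≡1-deeper : ∀ u V → res u 1 ≡ 1 → res u (suc V) % p ≡ 1
      res-≡1-deeper u V u≡1 = begin
          res u (suc V) % p     ≡⟨ sym (%P1≡%p (res u (suc V))) ⟩
          res u (suc V) %P 1    ≡⟨ cong (λ w → res u w %P 1) (+-comm 1 V) ⟩
          res u (V + 1) %P 1    ≡⟨ res-deeper u V 1 ⟩
          res u 1               ≡⟨ u≡1 ⟩
          1                     ∎
        where open ≡-Reasoning

      associated-≤ : ∀ E V E' V' → 0 < E → E < p → 0 < E' → E' < p → V < n → V ≤ V' →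
                     Associated (E * P V) (E' * P V') → V ≡ V' × E ≡ E'
      associated-≤ E V E' V' E>0 E<p E'>0 E'<p V<n V≤V' α with m≤n⇒m<n∨m≡n V≤V'
      ... | inj₁ V<V' = ⊥-elim (not-associated-deeper E V (E' * P V') E>0 E<p V<n (E*P-vanishes E' V' (suc V) V<V') α)
      ... | inj₂ refl = refl , *-cancelʳ-≡ E E' (P V) {{P≢0 V}} (begin
          E * P V                                   ≡⟨ associated-at E V (E' * P V) E<p V<n α ⟩
          (U * ((E' * P V) %P suc V)) %P suc V      ≡⟨ cong (λ w → (U * w) %P suc V) (%P-small (suc V) (*-monoˡ-< (P V) {{P≢0 V}} E'<p)) ⟩
          (U * (E' * P V)) %P suc V                 ≡⟨ cong (_%P suc V) (sym (*-assoc U E' (P V))) ⟩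
          _%_ (U * E' * P V) (p * P V) {{P≢0 (suc V)}} ≡⟨ sym (m%n*o≡m*o%[n*o] (U * E') p (P V) {{_}} {{P≢0 (suc V)}}) ⟩
          (U * E') % p * P V                        ≡⟨ cong (_* P V) (sym (%-absorbˡ-* U E' p)) ⟩
          (U % p * E') % p * P V                    ≡⟨ cong (λ w → (w * E') % p * P V) (res-≡1-deeper (proj₁ α) V (proj₁ (proj₂ α))) ⟩
          (1 * E') % p * P V                        ≡⟨ cong (λ w → w % p * P V) (*-identityˡ E') ⟩
          E' % p * P V                              ≡⟨ cong (_* P V) (m<n⇒m%n≡m E'<p) ⟩
          E' * P V                                  ∎)
        where
        open ≡-Reasoning
        U = res (proj₁ α) (suc V)

      associated-both-ways : ∀ E V E' V' → 0 < E → E < p → 0 < E' → E' < p → V < n → V' < n →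
        Associated (E * P V) (E' * P V') → Associated (E' * P V') (E * P V) → V ≡ V' × E ≡ E'
      associated-both-ways E V E' V' E>0 E<p E'>0 E'<p V<n V'<n α α' with ≤-total V V'
      ... | inj₁ V≤V' = associated-≤ E V E' V' E>0 E<p E'>0 E'<p V<n V≤V' α
      ... | inj₂ V'≤V with associated-≤ E' V' E V E'>0 E'<p E>0 E<p V'<n V'≤V α'
      ...   | V'≡V , E'≡E = sym V'≡V , sym E'≡E

      data ValuationView (x : ℤp) : Set where
        deep  : (z : ℤp) → x ≋ Pn ⊠ z → ValuationView x
        exact : (V : ℕ) → V < n → (z : ℤp) → x ≋ ι (P V) ⊠ z → res z 1 ≢ 0 → ValuationView x

      valuationView : ∀ x → ValuationView x
      valuationView x = peel n 0 refl x (≋-sym (ZR.*-identityˡ x))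
        where
        -- Divide out p while the cofactor vanishes mod p; V + j = n throughout.
        peel : ∀ j V → V + j ≡ n → (z : ℤp) → x ≋ ι (P V) ⊠ z → ValuationView x
        peel zero V V≡n z x≋p^Vz = deep z (≋-trans x≋p^Vz (ZR.*-congʳ (≡⇒≋ (cong (λ t → ι (P t)) (trans (sym (+-identityʳ V)) V≡n)))))
        peel (suc j) V V+j≡n z x≋p^Vz with res z 1 ≟ 0
        ... | no z≢0 = exact V (subst (V <_) V+j≡n (m<m+n V (s≤s z≤n))) z x≋p^Vz z≢0
        ... | yes z≡0 = peel j (suc V) (trans (sym (+-suc V j)) V+j≡n) z' (begin
              x                              ≈⟨ x≋p^Vz ⟩
              ι (P V) ⊠ z                    ≈⟨ ZR.*-congˡ (proj₂ quotient) ⟩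
              ι (P V) ⊠ (ι (P 1) ⊠ z')       ≈⟨ ZR.*-assoc (ι (P V)) (ι (P 1)) z' ⟨
              ι (P V) ⊠ ι (P 1) ⊠ z'         ≈⟨ ZR.*-congʳ (ι-* (P V) (P 1)) ⟨
              ι (P V * P 1) ⊠ z'             ≈⟨ ZR.*-congʳ (≡⇒≋ (cong ι (trans (sym (P-+ V 1)) (cong P (+-comm V 1))))) ⟩
              ι (P (suc V)) ⊠ z'             ∎)
          where
          open ≋-Reasoning
          quotient : Σ ℤp λ z' → z ≋ ι (P 1) ⊠ z'
          quotient = divide-by-P 1 z z≡0
          z' = proj₁ quotient

      record NormalForm (x : ℤp) (V : ℕ) : Set where
        field
          E      : ℕ
          E≢0    : E ≢ 0
          E<p    : E < p
          w w'   : ℤp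
          ww'≋1  : w ⊠ w' ≋ 𝟙
          w≡1    : res w 1 ≡ 1
          w'≡1   : res w' 1 ≡ 1
          x≋wEpᵛ : x ≋ w ⊠ ι (E * P V)

      normalForm : ∀ x V z → x ≋ ι (P V) ⊠ z → res z 1 ≢ 0 → NormalForm x V
      normalForm x V z x≋p^Vz z≢0 = record
        { E = E ; E≢0 = z≢0 ; E<p = subst (E <_) P1≡p (bound z 1) ; w = w ; w' = w' ; ww'≋1 = ww'≋1
        ; w≡1 = w≡1 ; w'≡1 = inverse-≡1 w' w w≡1 (≋-trans (ZR.*-comm w' w) ww'≋1) ; x≋wEpᵛ = x≋wEpᵛ }
        where
        open ≋-Reasoning
        E = res z 1
        ιE-invertible = unit-criterion (ι E) (λ E≡0 → z≢0 (trans (sym (res-reduced z 1)) E≡0))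
        E⁻¹ = proj₁ ιE-invertible
        w = z ⊠ E⁻¹
        w≡1 : res w 1 ≡ 1
        w≡1 = trans (res-⊠ z E⁻¹ 1) (trans (cong (λ t → (t * res E⁻¹ 1) %P 1) (sym (res-reduced z 1)))
                (trans (sym (res-⊠ (ι E) E⁻¹ 1)) (trans (un (proj₂ ιE-invertible) 1) 1%P1≡1)))
        w-invertible = unit-criterion w (λ w≡0 → 0≢1+n (trans (sym w≡0) w≡1))
        w' = proj₁ w-invertible
        ww'≋1 = proj₂ w-invertible
        x≋wEpᵛ : x ≋ w ⊠ ι (E * P V)
        x≋wEpᵛ = begin
          x                                ≈⟨ x≋p^Vz ⟩
          ι (P V) ⊠ z                      ≈⟨ ZR.*-identityʳ _ ⟨
          ι (P V) ⊠ z ⊠ 𝟙                  ≈⟨ ZR.*-congˡ (proj₂ ιE-invertible) ⟨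
          ι (P V) ⊠ z ⊠ (ι E ⊠ E⁻¹)        ≈⟨ solve 4 (λ a z b i → a :* z :* (b :* i) := z :* i :* (b :* a)) ≋-refl (ι (P V)) z (ι E) E⁻¹ ⟩
          z ⊠ E⁻¹ ⊠ (ι E ⊠ ι (P V))        ≈⟨ ZR.*-congˡ (ι-* E (P V)) ⟨
          w ⊠ ι (E * P V)                  ∎

    module DoubleCosets (m : ℕ) where
      n : ℕ
      n = suc m
      open UnitOrbits n
      open Counting p n

      -- An invertible matrix with lower-left entry in pⁿℤ_p lies in K₀(pⁿ):
      -- its diagonal entries are units since c ≡ 0 (mod p).
      K₀-criterion : ∀ k z → c k ≋ Pn ⊠ z → Invertible₂ k → InK₀ n k
      K₀-criterion k z c≋pⁿz (k⁻¹ , kk⁻¹≋I , k⁻¹k≋I) =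
          Invertible₂⇒InK (k⁻¹ , kk⁻¹≋I , k⁻¹k≋I)
        , Invertible⇒IsUnit (unit-criterion (a k) a≢0)
        , Invertible⇒IsUnit (unit-criterion (d k) d≢0)
        , (z , un (≋-trans c≋pⁿz (≋-sym (⊗≋⊠ Pn z))))
        where
        c≡0 : res (c k) 1 ≡ 0
        c≡0 = trans (un c≋pⁿz 1) (res-P-multiple-≤ n 1 (s≤s z≤n) z)
        d≢0 : res (d k) 1 ≢ 0
        d≢0 d≡0 = res-≡0-combination (c k) (d k) (b k⁻¹) (d k⁻¹) c≡0 d≡0 (qd kk⁻¹≋I)
        a≢0 : res (a k) 1 ≢ 0
        a≢0 a≡0 = res-≡0-combination (a k) (c k) (a k⁻¹) (b k⁻¹) a≡0 c≡0
          (≋-trans (ZR.+-cong (ZR.*-comm (a k) (a k⁻¹)) (ZR.*-comm (c k) (b k⁻¹))) (qa k⁻¹k≋I))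

      D-in-H : ∀ w → res w 1 ≡ 1 → InH (D w)
      D-in-H w w≡1 = (λ k → refl) , (λ k → refl) , (λ k → refl) , ≡1⇒∈1+pℤp w w≡1

      -- g ∈ K₀ r H as soon as k = r · D(w⁻¹) · g⁻¹ has lower-left entry in
      -- pⁿℤ_p, for some w ≡ 1 (mod p): then k ∈ K₀(pⁿ) and k g D(w) = r.
      same-coset-criterion : ∀ r g g⁻¹ w w⁻¹ z → Invertible₂ r → g ∙ g⁻¹ ≋M I → g⁻¹ ∙ g ≋M I →
        w ⊠ w⁻¹ ≋ 𝟙 → res w 1 ≡ 1 → c (r ∙ D w⁻¹ ∙ g⁻¹) ≋ Pn ⊠ z → SameDoubleCoset n g r
      same-coset-criterion r g g⁻¹ w w⁻¹ z r-inv gg⁻¹≋I g⁻¹g≋I ww⁻¹≋1 w≡1 c≋pⁿz =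
          k , D w , K₀-criterion k z c≋pⁿz k-inv , D-in-H w w≡1 , ≋M⇒≈M (≋M-trans (·≋∙∙ k g (D w)) kgD≋r)
        where
        open ≋M-Reasoning
        k = r ∙ D w⁻¹ ∙ g⁻¹
        w⁻¹w≋1 = ≋-trans (ZR.*-comm w⁻¹ w) ww⁻¹≋1
        k-inv : Invertible₂ k
        k-inv = Invertible₂-∙ (Invertible₂-∙ r-inv (D-invertible w⁻¹ w w⁻¹w≋1)) (g , g⁻¹g≋I , gg⁻¹≋I)
        kgD≋r : k ∙ g ∙ D w ≋M r
        kgD≋r = begin
          r ∙ D w⁻¹ ∙ g⁻¹ ∙ g ∙ D w       ≈⟨ ∙-cong (∙-assoc (r ∙ D w⁻¹) g⁻¹ g) (≋M-refl {D w}) ⟩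
          r ∙ D w⁻¹ ∙ (g⁻¹ ∙ g) ∙ D w     ≈⟨ ∙-cong (∙-cong (≋M-refl {r ∙ D w⁻¹}) g⁻¹g≋I) (≋M-refl {D w}) ⟩
          r ∙ D w⁻¹ ∙ I ∙ D w             ≈⟨ ∙-cong (∙-identityʳ (r ∙ D w⁻¹)) (≋M-refl {D w}) ⟩
          r ∙ D w⁻¹ ∙ D w                 ≈⟨ ∙-assoc r (D w⁻¹) (D w) ⟩
          r ∙ (D w⁻¹ ∙ D w)               ≈⟨ ∙-cong (≋M-refl {r}) (D-∙ w⁻¹ w w⁻¹w≋1) ⟩
          r ∙ I                           ≈⟨ ∙-identityʳ r ⟩
          r                               ∎

      isolate : ∀ x y t → x ⊞ y ⊠ t ≋ 𝟘 → x ≋ y ⊠ ⊟ t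
      isolate x y t x+yt≋0 = begin
          x                        ≈⟨ solve 3 (λ x y m → x := x :+ y :* con 0) ≋-refl x y (⊟ t) ⟩
          x ⊞ y ⊠ 𝟘                ≈⟨ ZR.+-congˡ (ZR.*-congˡ (ZR.-‿inverseʳ t)) ⟨
          x ⊞ y ⊠ (t ⊞ ⊟ t)        ≈⟨ solve 4 (λ x y t m → x :+ y :* (t :+ m) := (x :+ y :* t) :+ y :* m) ≋-refl x y t (⊟ t) ⟩
          (x ⊞ y ⊠ t) ⊞ y ⊠ ⊟ t    ≈⟨ ZR.+-congʳ x+yt≋0 ⟩
          𝟘 ⊞ y ⊠ ⊟ t              ≈⟨ ZR.+-identityˡ _ ⟩
          y ⊠ ⊟ t                  ∎
        where open ≋-Reasoning

      reduce-to-L : ∀ g g⁻¹ → g ∙ g⁻¹ ≋M I → g⁻¹ ∙ g ≋M I → ∀ δ x w w⁻¹ s →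
        d g ⊠ δ ≋ 𝟙 → w ⊠ w⁻¹ ≋ 𝟙 → res w 1 ≡ 1 → c g ⊠ δ ≋ w ⊠ x ⊞ Pn ⊠ s →
        SameDoubleCoset n g (L x)
      reduce-to-L g g⁻¹ gg⁻¹≋I g⁻¹g≋I δ x w w⁻¹ s dδ≋1 ww⁻¹≋1 w≡1 cδ≋wx+pⁿs =
        same-coset-criterion (L x) g g⁻¹ w w⁻¹ _ (L-invertible x) gg⁻¹≋I g⁻¹g≋I ww⁻¹≋1 w≡1
          (isolate _ Pn (w⁻¹ ⊠ s ⊠ a') lower-left)
        where
        open ≋-Reasoning
        a' = a g⁻¹
        c' = c g⁻¹
        -- lower-left entry of L(x) D(w⁻¹) g⁻¹, plus pⁿ w⁻¹ s a', is w⁻¹ δ (g g⁻¹)₂₁ = 0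
        lower-left : (x ⊠ 𝟙 ⊞ 𝟙 ⊠ 𝟘) ⊠ a' ⊞ (x ⊠ 𝟘 ⊞ 𝟙 ⊠ w⁻¹) ⊠ c' ⊞ Pn ⊠ (w⁻¹ ⊠ s ⊠ a') ≋ 𝟘
        lower-left = begin
          (x ⊠ 𝟙 ⊞ 𝟙 ⊠ 𝟘) ⊠ a' ⊞ (x ⊠ 𝟘 ⊞ 𝟙 ⊠ w⁻¹) ⊠ c' ⊞ Pn ⊠ (w⁻¹ ⊠ s ⊠ a')
            ≈⟨ solve 6 (λ x a' w' c' q s → (x :* con 1 :+ con 1 :* con 0) :* a' :+ (x :* con 0 :+ con 1 :* w') :* c' :+ q :* (w' :* s :* a')
                       := (x :* a') :* con 1 :+ w' :* c' :+ q :* (w' :* s :* a')) ≋-refl x a' w⁻¹ c' Pn s ⟩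
          (x ⊠ a') ⊠ 𝟙 ⊞ w⁻¹ ⊠ c' ⊞ Pn ⊠ (w⁻¹ ⊠ s ⊠ a')
            ≈⟨ ZR.+-congʳ (ZR.+-congʳ (ZR.*-congˡ ww⁻¹≋1)) ⟨
          (x ⊠ a') ⊠ (w ⊠ w⁻¹) ⊞ w⁻¹ ⊠ c' ⊞ Pn ⊠ (w⁻¹ ⊠ s ⊠ a')
            ≈⟨ solve 7 (λ x a' w w' c' q s → (x :* a') :* (w :* w') :+ w' :* c' :+ q :* (w' :* s :* a')
                       := w' :* (a' :* (w :* x :+ q :* s)) :+ w' :* (c' :* con 1)) ≋-refl x a' w w⁻¹ c' Pn s ⟩
          w⁻¹ ⊠ (a' ⊠ (w ⊠ x ⊞ Pn ⊠ s)) ⊞ w⁻¹ ⊠ (c' ⊠ 𝟙)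
            ≈⟨ ZR.+-cong (ZR.*-congˡ (ZR.*-congˡ cδ≋wx+pⁿs)) (ZR.*-congˡ (ZR.*-congˡ dδ≋1)) ⟨
          w⁻¹ ⊠ (a' ⊠ (c g ⊠ δ)) ⊞ w⁻¹ ⊠ (c' ⊠ (d g ⊠ δ))
            ≈⟨ solve 6 (λ w' a' cg δ c' dg → w' :* (a' :* (cg :* δ)) :+ w' :* (c' :* (dg :* δ)) := (w' :* δ) :* (cg :* a' :+ dg :* c')) ≋-refl w⁻¹ a' (c g) δ c' (d g) ⟩
          (w⁻¹ ⊠ δ) ⊠ (c g ⊠ a' ⊞ d g ⊠ c')
            ≈⟨ ZR.*-congˡ (qc gg⁻¹≋I) ⟩
          (w⁻¹ ⊠ δ) ⊠ 𝟘
            ≈⟨ ZR.zeroʳ (w⁻¹ ⊠ δ) ⟩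
          𝟘 ∎

      reduce-to-R : ∀ g g⁻¹ → g ∙ g⁻¹ ≋M I → g⁻¹ ∙ g ≋M I → ∀ γ y w w⁻¹ s →
        c g ⊠ γ ≋ 𝟙 → w ⊠ w⁻¹ ≋ 𝟙 → res w 1 ≡ 1 → d g ⊠ γ ≋ w ⊠ y ⊞ Pn ⊠ s →
        SameDoubleCoset n g (R y)
      reduce-to-R g g⁻¹ gg⁻¹≋I g⁻¹g≋I γ y w w⁻¹ s cγ≋1 ww⁻¹≋1 w≡1 dγ≋wy+pⁿs =
        same-coset-criterion (R y) g g⁻¹ w⁻¹ w _ (R-invertible y) gg⁻¹≋I g⁻¹g≋I
          (≋-trans (ZR.*-comm w⁻¹ w) ww⁻¹≋1) (inverse-≡1 w⁻¹ w w≡1 (≋-trans (ZR.*-comm w⁻¹ w) ww⁻¹≋1))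
          (isolate _ Pn (s ⊠ c') lower-left)
        where
        open ≋-Reasoning
        a' = a g⁻¹
        c' = c g⁻¹
        -- lower-left entry of R(y) D(w) g⁻¹, plus pⁿ s c', is γ (g g⁻¹)₂₁ = 0
        lower-left : (𝟙 ⊠ 𝟙 ⊞ y ⊠ 𝟘) ⊠ a' ⊞ (𝟙 ⊠ 𝟘 ⊞ y ⊠ w) ⊠ c' ⊞ Pn ⊠ (s ⊠ c') ≋ 𝟘
        lower-left = begin
          (𝟙 ⊠ 𝟙 ⊞ y ⊠ 𝟘) ⊠ a' ⊞ (𝟙 ⊠ 𝟘 ⊞ y ⊠ w) ⊠ c' ⊞ Pn ⊠ (s ⊠ c')
            ≈⟨ solve 6 (λ y a' w c' q s → (con 1 :* con 1 :+ y :* con 0) :* a' :+ (con 1 :* con 0 :+ y :* w) :* c' :+ q :* (s :* c')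
                       := a' :* con 1 :+ c' :* (w :* y :+ q :* s)) ≋-refl y a' w c' Pn s ⟩
          a' ⊠ 𝟙 ⊞ c' ⊠ (w ⊠ y ⊞ Pn ⊠ s)
            ≈⟨ ZR.+-cong (ZR.*-congˡ cγ≋1) (ZR.*-congˡ dγ≋wy+pⁿs) ⟨
          a' ⊠ (c g ⊠ γ) ⊞ c' ⊠ (d g ⊠ γ)
            ≈⟨ solve 5 (λ a' cg γ c' dg → a' :* (cg :* γ) :+ c' :* (dg :* γ) := γ :* (cg :* a' :+ dg :* c')) ≋-refl a' (c g) γ c' (d g) ⟩
          γ ⊠ (c g ⊠ a' ⊞ d g ⊠ c')
            ≈⟨ ZR.*-congˡ (qc gg⁻¹≋I) ⟩
          γ ⊠ 𝟘
            ≈⟨ ZR.zeroʳ γ ⟩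
          𝟘 ∎

      record CosetRelation (r r' : Mat) : Set where
        field
          k : Mat
          u : ℤp
          z : ℤp
          c≋pⁿz : c k ≋ Pn ⊠ z
          d-invertible : Invertible (d k)
          u≡1 : res u 1 ≡ 1
          krD≋r' : k ∙ r ∙ D u ≋M r'

      coset-relation : ∀ r r' → SameDoubleCoset n r r' → CosetRelation r r'
      coset-relation r r' (k , h , (_ , _ , d-unit , (z , c≈pⁿz)) , (h-a , h-b , h-c , (zh , h-d)) , khr≈r') = record
        { k = k ; u = d h ; z = z
        ; c≋pⁿz = ≋-trans (≋i c≈pⁿz) (⊗≋⊠ Pn z)
        ; d-invertible = IsUnit⇒Invertible d-unit
        ; u≡1 = ∈1+pℤp⇒≡1 (d h) zh h-d
        ; krD≋r' = ≋M-trans (∙-cong (≋M-refl {k ∙ r}) (≋M-sym h≋D)) (≋M-trans (≋M-sym (·≋∙∙ k r h)) (≈M⇒≋M khr≈r')) }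
        where
        h≋D : h ≋M D (d h)
        h≋D = mq (≋i h-a) (≋i h-b) (≋i h-c) ≋-refl

      L-cosets-associated : ∀ X X' → SameDoubleCoset n (L (ι X)) (L (ι X')) → Associated X X' × Associated X' X
      L-cosets-associated X X' same =
        associated-fromˡ X X' u (u ⊠ z) u≡1 X+pⁿuz≋uX' , associated-fromʳ X' X δ z δ≡1 X'≋δX+pⁿz
        where
        open CosetRelation (coset-relation (L (ι X)) (L (ι X')) same)
        open ≋-Reasoning
        γ = c k
        δ = d k
        x = ι X
        x' = ι X'
        lower-left : γ ⊞ δ ⊠ x ≋ x'
        lower-left = ≋-trans (solve 3 (λ γ δ x → γ :+ δ :* x := (γ :* con 1 :+ δ :* x) :* con 1 :+ (γ :* con 0 :+ δ :* con 1) :* con 0) ≋-refl γ δ x) (qc krD≋r')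
        δu≋1 : δ ⊠ u ≋ 𝟙
        δu≋1 = ≋-trans (solve 4 (λ γ δ x u → δ :* u := (γ :* con 1 :+ δ :* x) :* con 0 :+ (γ :* con 0 :+ δ :* con 1) :* u) ≋-refl γ δ x u) (qd krD≋r')
        δ≡1 : res δ 1 ≡ 1
        δ≡1 = inverse-≡1 δ u u≡1 δu≋1
        X'≋δX+pⁿz : x' ≋ δ ⊠ x ⊞ Pn ⊠ z
        X'≋δX+pⁿz = begin
          x'                  ≈⟨ lower-left ⟨
          γ ⊞ δ ⊠ x           ≈⟨ ZR.+-congʳ c≋pⁿz ⟩
          Pn ⊠ z ⊞ δ ⊠ x      ≈⟨ ZR.+-comm _ _ ⟩
          δ ⊠ x ⊞ Pn ⊠ z      ∎
        X+pⁿuz≋uX' : x ⊞ Pn ⊠ (u ⊠ z) ≋ u ⊠ x'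
        X+pⁿuz≋uX' = begin
          x ⊞ Pn ⊠ (u ⊠ z)              ≈⟨ ZR.+-congʳ (ZR.*-identityˡ x) ⟨
          𝟙 ⊠ x ⊞ Pn ⊠ (u ⊠ z)          ≈⟨ ZR.+-congʳ (ZR.*-congʳ (≋-trans (ZR.*-comm u δ) δu≋1)) ⟨
          (u ⊠ δ) ⊠ x ⊞ Pn ⊠ (u ⊠ z)    ≈⟨ solve 5 (λ u δ x q z → (u :* δ) :* x :+ q :* (u :* z) := u :* (δ :* x :+ q :* z)) ≋-refl u δ x Pn z ⟩
          u ⊠ (δ ⊠ x ⊞ Pn ⊠ z)          ≈⟨ ZR.*-congˡ X'≋δX+pⁿz ⟨
          u ⊠ x'                        ∎

      R-cosets-associated : ∀ Y Y' → SameDoubleCoset n (R (ι Y)) (R (ι Y')) → Associated Y Y' × Associated Y' Y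
      R-cosets-associated Y Y' same =
        associated-fromˡ Y Y' u⁻¹ (u⁻¹ ⊠ (z ⊠ u)) u⁻¹≡1 Y+pⁿu⁻¹zu≋u⁻¹Y' , associated-fromʳ Y' Y u (z ⊠ u) u≡1 Y'≋uY+pⁿzu
        where
        open CosetRelation (coset-relation (R (ι Y)) (R (ι Y')) same)
        open ≋-Reasoning
        γ = c k
        δ = d k
        y = ι Y
        y' = ι Y'
        δ≋1 : δ ≋ 𝟙
        δ≋1 = ≋-trans (solve 4 (λ γ δ y u → δ := (γ :* con 0 :+ δ :* con 1) :* con 1 :+ (γ :* con 1 :+ δ :* y) :* con 0) ≋-refl γ δ y u) (qc krD≋r')
        lower-right : (γ ⊞ δ ⊠ y) ⊠ u ≋ y'
        lower-right = ≋-trans (solve 4 (λ γ δ y u → (γ :+ δ :* y) :* u := (γ :* con 0 :+ δ :* con 1) :* con 0 :+ (γ :* con 1 :+ δ :* y) :* u) ≋-refl γ δ y u) (qd krD≋r')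
        Y'≋uY+pⁿzu : y' ≋ u ⊠ y ⊞ Pn ⊠ (z ⊠ u)
        Y'≋uY+pⁿzu = begin
          y'                          ≈⟨ lower-right ⟨
          (γ ⊞ δ ⊠ y) ⊠ u             ≈⟨ ZR.*-congʳ (ZR.+-cong c≋pⁿz (ZR.*-congʳ δ≋1)) ⟩
          (Pn ⊠ z ⊞ 𝟙 ⊠ y) ⊠ u        ≈⟨ solve 4 (λ q z y u → (q :* z :+ con 1 :* y) :* u := u :* y :+ q :* (z :* u)) ≋-refl Pn z y u ⟩
          u ⊠ y ⊞ Pn ⊠ (z ⊠ u)        ∎
        u-invertible = unit-criterion u (λ u≡0 → 0≢1+n (trans (sym u≡0) u≡1))
        u⁻¹ = proj₁ u-invertible
        uu⁻¹≋1 = proj₂ u-invertible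
        u⁻¹≡1 : res u⁻¹ 1 ≡ 1
        u⁻¹≡1 = inverse-≡1 u⁻¹ u u≡1 (≋-trans (ZR.*-comm u⁻¹ u) uu⁻¹≋1)
        Y+pⁿu⁻¹zu≋u⁻¹Y' : y ⊞ Pn ⊠ (u⁻¹ ⊠ (z ⊠ u)) ≋ u⁻¹ ⊠ y'
        Y+pⁿu⁻¹zu≋u⁻¹Y' = begin
          y ⊞ Pn ⊠ (u⁻¹ ⊠ (z ⊠ u))              ≈⟨ ZR.+-congʳ (ZR.*-identityˡ y) ⟨
          𝟙 ⊠ y ⊞ Pn ⊠ (u⁻¹ ⊠ (z ⊠ u))          ≈⟨ ZR.+-congʳ (ZR.*-congʳ uu⁻¹≋1) ⟨
          (u ⊠ u⁻¹) ⊠ y ⊞ Pn ⊠ (u⁻¹ ⊠ (z ⊠ u))  ≈⟨ solve 5 (λ u u' y q z → (u :* u') :* y :+ q :* (u' :* (z :* u)) := u' :* (u :* y :+ q :* (z :* u))) ≋-refl u u⁻¹ y Pn z ⟩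
          u⁻¹ ⊠ (u ⊠ y ⊞ Pn ⊠ (z ⊠ u))          ≈⟨ ZR.*-congˡ Y'≋uY+pⁿzu ⟨
          u⁻¹ ⊠ y'                              ∎

      -- L(X) and R(Y) with p ∣ Y lie in different double cosets: the lower-right
      -- entry d(k)·u of k L(X) D(u) is a unit, while Y is not.
      L≁R : ∀ X Y → Y %P 1 ≡ 0 → ¬ SameDoubleCoset n (L (ι X)) (R (ι Y))
      L≁R X Y Y≡0 same = Invertible⇒res≢0 δ d-invertible (trans (sym (res-⊠-≡1 δ u u≡1)) (trans (un δu≋Y 1) Y≡0))
        where
        open CosetRelation (coset-relation (L (ι X)) (R (ι Y)) same)
        γ = c k
        δ = d k
        δu≋Y : δ ⊠ u ≋ ι Y
        δu≋Y = ≋-trans (solve 4 (λ γ δ x u → δ :* u := (γ :* con 1 :+ δ :* x) :* con 0 :+ (γ :* con 0 :+ δ :* con 1) :* u) ≋-refl γ δ (ι X) u) (qd krD≋r')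

      -- Symmetrically, the lower-right entry (c(k) + d(k) Y) u of k R(Y) D(u) is
      -- ≡ 0 (mod p), so it cannot be the entry 1 of L(X).
      R≁L : ∀ Y X → Y %P 1 ≡ 0 → ¬ SameDoubleCoset n (R (ι Y)) (L (ι X))
      R≁L Y X Y≡0 same = res-≡0-≉𝟙 ((γ ⊞ δ ⊠ ι Y) ⊠ u) lower-right≡0 lower-right≋1
        where
        open CosetRelation (coset-relation (R (ι Y)) (L (ι X)) same)
        γ = c k
        δ = d k
        lower-right≋1 : (γ ⊞ δ ⊠ ι Y) ⊠ u ≋ 𝟙
        lower-right≋1 = ≋-trans (solve 4 (λ γ δ y u → (γ :+ δ :* y) :* u := (γ :* con 0 :+ δ :* con 1) :* con 0 :+ (γ :* con 1 :+ δ :* y) :* u) ≋-refl γ δ (ι Y) u) (qd krD≋r')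
        γ≡0 : res γ 1 ≡ 0
        γ≡0 = trans (un c≋pⁿz 1) (res-P-multiple-≤ n 1 (s≤s z≤n) z)
        lower-right≡0 : res ((γ ⊞ δ ⊠ ι Y) ⊠ u) 1 ≡ 0
        lower-right≡0 = res-⊠-zeroˡ (γ ⊞ δ ⊠ ι Y) u 1 (trans (res-⊞-zeroʳ γ (δ ⊠ ι Y) 1 (res-⊠-zeroʳ δ (ι Y) 1 Y≡0)) γ≡0)

      -- Labels of the double cosets: L(0), R(0), L(e p^v) for v < n and
      -- R(e p^(v+1)) for v < m, where e = 1 … p − 1 is coded by Fin (p − 1).
      q : ℕ
      q = p ∸ 1

      data Label : Set where
        L-zero R-zero : Label
        L-digit : Fin n → Fin q → Label
        R-digit : Fin m → Fin q → Label

      digit : Fin q → ℕ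
      digit e = suc (toℕ e)

      digit<p : ∀ e → digit e < p
      digit<p e = subst (digit e <_) (m+[n∸m]≡n {1} {p} (<⇒≤ p>1)) (s≤s (toℕ<n e))

      digit>0 : ∀ e → 0 < digit e
      digit>0 e = s≤s z≤n

      digit-of : ∀ E → E ≢ 0 → E < p → Σ (Fin q) λ e → digit e ≡ E
      digit-of zero E≢0 _ = ⊥-elim (E≢0 refl)
      digit-of (suc E) _ E<p = fromℕ< E<q , cong suc (toℕ-fromℕ< E<q)
        where
        E<q : E < q
        E<q = s≤s⁻¹ (subst (suc E <_) (sym (m+[n∸m]≡n {1} {p} (<⇒≤ p>1))) E<p)

      L-value : Fin n → Fin q → ℕ
      L-value v e = digit e * P (toℕ v)

      R-value : Fin m → Fin q → ℕ
      R-value v e = digit e * P (suc (toℕ v))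

      representative : Label → Mat
      representative L-zero = L (ι 0)
      representative R-zero = R (ι 0)
      representative (L-digit v e) = L (ι (L-value v e))
      representative (R-digit v e) = R (ι (R-value v e))

      representative-invertible : ∀ ℓ → Invertible₂ (representative ℓ)
      representative-invertible L-zero = L-invertible (ι 0)
      representative-invertible R-zero = R-invertible (ι 0)
      representative-invertible (L-digit v e) = L-invertible (ι (L-value v e))
      representative-invertible (R-digit v e) = R-invertible (ι (R-value v e))

      R-value≡0 : ∀ v e → R-value v e %P 1 ≡ 0
      R-value≡0 v e = E*P-vanishes (digit e) (suc (toℕ v)) 1 (s≤s z≤n)

      representatives-separated : ∀ ℓ ℓ' → SameDoubleCoset n (representative ℓ) (representative ℓ') → ℓ ≡ ℓ'
      representatives-separated L-zero L-zero _ = refl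
      representatives-separated R-zero R-zero _ = refl
      representatives-separated L-zero (L-digit v e) same =
        ⊥-elim (not-associated-deeper (digit e) (toℕ v) 0 (digit>0 e) (digit<p e) (toℕ<n v) (0%P (suc (toℕ v)))
                 (proj₂ (L-cosets-associated 0 (L-value v e) same)))
      representatives-separated (L-digit v e) L-zero same =
        ⊥-elim (not-associated-deeper (digit e) (toℕ v) 0 (digit>0 e) (digit<p e) (toℕ<n v) (0%P (suc (toℕ v)))
                 (proj₁ (L-cosets-associated (L-value v e) 0 same)))
      representatives-separated R-zero (R-digit v e) same =
        ⊥-elim (not-associated-deeper (digit e) (suc (toℕ v)) 0 (digit>0 e) (digit<p e) (s≤s (toℕ<n v)) (0%P (suc (suc (toℕ v))))
                 (proj₂ (R-cosets-associated 0 (R-value v e) same)))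
      representatives-separated (R-digit v e) R-zero same =
        ⊥-elim (not-associated-deeper (digit e) (suc (toℕ v)) 0 (digit>0 e) (digit<p e) (s≤s (toℕ<n v)) (0%P (suc (suc (toℕ v))))
                 (proj₁ (R-cosets-associated (R-value v e) 0 same)))
      representatives-separated (L-digit v e) (L-digit v' e') same =
        cong₂ L-digit (toℕ-injective (proj₁ v≡v'×e≡e')) (toℕ-injective (suc-injective (proj₂ v≡v'×e≡e')))
        where
        α = L-cosets-associated (L-value v e) (L-value v' e') same
        v≡v'×e≡e' = associated-both-ways (digit e) (toℕ v) (digit e') (toℕ v')
          (digit>0 e) (digit<p e) (digit>0 e') (digit<p e') (toℕ<n v) (toℕ<n v') (proj₁ α) (proj₂ α)
      representatives-separated (R-digit v e) (R-digit v' e') same =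
        cong₂ R-digit (toℕ-injective (suc-injective (proj₁ v≡v'×e≡e'))) (toℕ-injective (suc-injective (proj₂ v≡v'×e≡e')))
        where
        α = R-cosets-associated (R-value v e) (R-value v' e') same
        v≡v'×e≡e' = associated-both-ways (digit e) (suc (toℕ v)) (digit e') (suc (toℕ v'))
          (digit>0 e) (digit<p e) (digit>0 e') (digit<p e') (s≤s (toℕ<n v)) (s≤s (toℕ<n v')) (proj₁ α) (proj₂ α)
      representatives-separated L-zero R-zero same = ⊥-elim (L≁R 0 0 (0%P 1) same)
      representatives-separated L-zero (R-digit v e) same = ⊥-elim (L≁R 0 (R-value v e) (R-value≡0 v e) same)
      representatives-separated (L-digit v' e') R-zero same = ⊥-elim (L≁R (L-value v' e') 0 (0%P 1) same)
      representatives-separated (L-digit v' e') (R-digit v e) same = ⊥-elim (L≁R (L-value v' e') (R-value v e) (R-value≡0 v e) same)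
      representatives-separated R-zero L-zero same = ⊥-elim (R≁L 0 0 (0%P 1) same)
      representatives-separated R-zero (L-digit v e) same = ⊥-elim (R≁L 0 (L-value v e) (0%P 1) same)
      representatives-separated (R-digit v e) L-zero same = ⊥-elim (R≁L (R-value v e) 0 (R-value≡0 v e) same)
      representatives-separated (R-digit v e) (L-digit v' e') same = ⊥-elim (R≁L (R-value v e) (L-value v' e') (R-value≡0 v e) same)

      -- x ≋ x + pⁿ·0, the shape expected by reduce-to-L and reduce-to-R.
      ≋-+pⁿ0 : ∀ {x y} → x ≋ y → x ≋ y ⊞ Pn ⊠ 𝟘
      ≋-+pⁿ0 {x} {y} x≋y = ≋-trans x≋y (solve 2 (λ y q → y := y :+ q :* con 0) ≋-refl y Pn)

      -- pⁿ z = 1·0 + pⁿ z, the shape expected for the representatives L(0), R(0).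
      pⁿz≋0+pⁿz : ∀ z → Pn ⊠ z ≋ 𝟙 ⊠ ι 0 ⊞ Pn ⊠ z
      pⁿz≋0+pⁿz z = solve 2 (λ q z → q :* z := con 1 :* con 0 :+ q :* z) ≋-refl Pn z

      classify-d-unit : ∀ g g⁻¹ → g ∙ g⁻¹ ≋M I → g⁻¹ ∙ g ≋M I → ∀ δ → d g ⊠ δ ≋ 𝟙 →
        Σ Label λ ℓ → SameDoubleCoset n g (representative ℓ)
      classify-d-unit g g⁻¹ gg⁻¹ g⁻¹g δ dδ≋1 = by-valuation (valuationView (c g ⊠ δ))
        where
        by-valuation : ValuationView (c g ⊠ δ) → Σ Label λ ℓ → SameDoubleCoset n g (representative ℓ)
        by-valuation (deep z cδ≋pⁿz) = L-zero ,
          reduce-to-L g g⁻¹ gg⁻¹ g⁻¹g δ (ι 0) 𝟙 𝟙 z dδ≋1 (ZR.*-identityˡ 𝟙) 1%P1≡1 (≋-trans cδ≋pⁿz (pⁿz≋0+pⁿz z))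
        by-valuation (exact V V<n z cδ≋pᵛz z≢0) = from-normal-form (normalForm (c g ⊠ δ) V z cδ≋pᵛz z≢0)
          where
          from-normal-form : NormalForm (c g ⊠ δ) V → Σ Label λ ℓ → SameDoubleCoset n g (representative ℓ)
          from-normal-form nf = L-digit (fromℕ< V<n) e ,
            subst (SameDoubleCoset n g) (cong (λ t → L (ι t)) (cong₂ _*_ (sym digit≡E) (cong P (sym (toℕ-fromℕ< V<n)))))
              (reduce-to-L g g⁻¹ gg⁻¹ g⁻¹g δ (ι (E * P V)) w w' 𝟘 dδ≋1 ww'≋1 w≡1 (≋-+pⁿ0 x≋wEpᵛ))
            where
            open NormalForm nf
            e = proj₁ (digit-of E E≢0 E<p)
            digit≡E = proj₂ (digit-of E E≢0 E<p)

      classify-d-nonunit : ∀ g g⁻¹ → g ∙ g⁻¹ ≋M I → g⁻¹ ∙ g ≋M I → res (d g) 1 ≡ 0 → ∀ γ → c g ⊠ γ ≋ 𝟙 →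
        Σ Label λ ℓ → SameDoubleCoset n g (representative ℓ)
      classify-d-nonunit g g⁻¹ gg⁻¹ g⁻¹g d≡0 γ cγ≋1 = by-valuation (valuationView (d g ⊠ γ))
        where
        by-valuation : ValuationView (d g ⊠ γ) → Σ Label λ ℓ → SameDoubleCoset n g (representative ℓ)
        by-valuation (deep z dγ≋pⁿz) = R-zero ,
          reduce-to-R g g⁻¹ gg⁻¹ g⁻¹g γ (ι 0) 𝟙 𝟙 z cγ≋1 (ZR.*-identityˡ 𝟙) 1%P1≡1 (≋-trans dγ≋pⁿz (pⁿz≋0+pⁿz z))
        by-valuation (exact zero _ z dγ≋z z≢0) =
          ⊥-elim (z≢0 (trans (sym (un (ZR.*-identityˡ z) 1)) (trans (sym (un dγ≋z 1)) (res-⊠-zeroˡ (d g) γ 1 d≡0))))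
        by-valuation (exact (suc V) V<n z dγ≋pᵛz z≢0) = from-normal-form (normalForm (d g ⊠ γ) (suc V) z dγ≋pᵛz z≢0)
          where
          from-normal-form : NormalForm (d g ⊠ γ) (suc V) → Σ Label λ ℓ → SameDoubleCoset n g (representative ℓ)
          from-normal-form nf = R-digit (fromℕ< (s≤s⁻¹ V<n)) e ,
            subst (SameDoubleCoset n g) (cong (λ t → R (ι t)) (cong₂ _*_ (sym digit≡E) (cong (λ t → P (suc t)) (sym (toℕ-fromℕ< (s≤s⁻¹ V<n))))))
              (reduce-to-R g g⁻¹ gg⁻¹ g⁻¹g γ (ι (E * P (suc V))) w w' 𝟘 cγ≋1 ww'≋1 w≡1 (≋-+pⁿ0 x≋wEpᵛ))
            where
            open NormalForm nf
            e = proj₁ (digit-of E E≢0 E<p)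
            digit≡E = proj₂ (digit-of E E≢0 E<p)

      classify : ∀ g → Invertible₂ g → Σ Label λ ℓ → SameDoubleCoset n g (representative ℓ)
      classify g (g⁻¹ , gg⁻¹ , g⁻¹g) = by-d (res (d g) 1 ≟ 0)
        where
        by-d : Dec (res (d g) 1 ≡ 0) → Σ Label λ ℓ → SameDoubleCoset n g (representative ℓ)
        by-d (no d≢0) = classify-d-unit g g⁻¹ gg⁻¹ g⁻¹g (proj₁ d⁻¹) (proj₂ d⁻¹)
          where d⁻¹ = unit-criterion (d g) d≢0
        by-d (yes d≡0) = classify-d-nonunit g g⁻¹ gg⁻¹ g⁻¹g d≡0 (proj₁ c⁻¹) (proj₂ c⁻¹)
          where
          c≢0 : res (c g) 1 ≢ 0
          c≢0 c≡0 = res-≡0-combination (c g) (d g) (b g⁻¹) (d g⁻¹) c≡0 d≡0 (qd gg⁻¹)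
          c⁻¹ = unit-criterion (c g) c≢0

      -- Fin (2 + (n + m)(p − 1)) ≅ Fin 2 ⊎ (Fin n ⊎ Fin m) × Fin (p − 1) ≅ Label.
      label-enumeration : Fin (2 + (n + m) * q) ↔ Label
      label-enumeration =
        ↔-trans (+↔⊎ {2} {(n + m) * q})
        (↔-trans (↔-refl ⊎-↔ ↔-trans (*↔× {n + m} {q}) (+↔⊎ {n} {m} ×-↔ ↔-refl))
                 sum↔Label)
        where
        to : Fin 2 ⊎ (Fin n ⊎ Fin m) × Fin q → Label
        to (inj₁ zero) = L-zero
        to (inj₁ (suc zero)) = R-zero
        to (inj₂ (inj₁ v , e)) = L-digit v e
        to (inj₂ (inj₂ v , e)) = R-digit v e
        from : Label → Fin 2 ⊎ (Fin n ⊎ Fin m) × Fin q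
        from L-zero = inj₁ zero
        from R-zero = inj₁ (suc zero)
        from (L-digit v e) = inj₂ (inj₁ v , e)
        from (R-digit v e) = inj₂ (inj₂ v , e)
        to∘from : ∀ ℓ → to (from ℓ) ≡ ℓ
        to∘from L-zero = refl
        to∘from R-zero = refl
        to∘from (L-digit v e) = refl
        to∘from (R-digit v e) = refl
        from∘to : ∀ s → from (to s) ≡ s
        from∘to (inj₁ zero) = refl
        from∘to (inj₁ (suc zero)) = refl
        from∘to (inj₂ (inj₁ v , e)) = refl
        from∘to (inj₂ (inj₂ v , e)) = refl
        sum↔Label : (Fin 2 ⊎ (Fin n ⊎ Fin m) × Fin q) ↔ Label
        sum↔Label = mk↔ₛ′ to from to∘from from∘to

      double-coset-count : DoubleCosetCount n (2 + (n + m) * q)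
      double-coset-count = count-by-labels label-enumeration representative
        (λ ℓ → Invertible₂⇒InK (representative-invertible ℓ))
        representatives-separated
        (λ g g∈K → classify g (InK⇒Invertible₂ g∈K))

count-formula : ∀ m p → 2 + (suc m + m) * (p ∸ 1) ≡ (2 * suc m ∸ 1) * (p ∸ 1) + 2
count-formula m p = trans (+-comm 2 _) (cong (λ t → t * (p ∸ 1) + 2) n+m≡2n-1)
  where
  n+m≡2n-1 : suc m + m ≡ 2 * suc m ∸ 1
  n+m≡2n-1 = sym (trans (+-suc m (m + 0)) (cong (λ t → suc (m + t)) (+-identityʳ m)))

lemma4p3 : (p : ℕ) (pr : Prime p) (n : ℕ) → 1 ≤ n →
    CountK₀\K/H p pr n ((2 * n ∸ 1) * (p ∸ 1) + 2)
lemma4p3 p pr (suc m) _ = subst (CountK₀\K/H p pr (suc m)) (count-formula m p) count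
  where
  count : CountK₀\K/H p pr (suc m) (2 + (suc m + m) * (p ∸ 1))
  count = PadicRing.Units.DoubleCosets.double-coset-count p {{prime⇒nonZero pr}} pr m
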